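{- Let $a,b$ be odd positive integers and $n$ a positive integer. Then $$N(a,a,2a,b;2n+a+b)=\frac 13\Big(N(a,a,a,2b;4n+2a+2b)+2N\big(a,a,a,2b;n+\tfrac{a+b}2\big)\Big)$$ and $$t(a,2a,4a,b;n)=\frac 16\Big(N(a,a,a,2b;16n+14a+2b)-N\big(a,a,a,2b;4n+\tfrac{7a+b}2\big)\Big).$$
   Context: For positive integers $a_1,\dots,a_k$ and a nonnegative integer $n$, $N(a_1,\dots,a_k;n)$ is the number of $(x_1,\dots,x_k)\in\mathbb Z^k$ with $n=a_1x_1^2+\cdots+a_kx_k^2$, and $t(a_1,\dots,a_k;n)$ is the number of $(x_1,\dots,x_k)\in\mathbb Z^k$ with $n=a_1\frac{x_1(x_1-1)}2+\cdots+a_k\frac{x_k(x_k-1)}2$. -}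

module Defs where

open import Data.Nat as ℕ using (ℕ; zero; suc; _∸_)
open import Data.Nat.DivMod using (_/_)
open import Data.Integer as ℤ using (ℤ; +_; -[1+_])
open import Data.List using (List; []; _∷_; map; upTo)
open import Data.Nat.ListAction using (sum)
open import Data.Product using (Σ)
open import Relation.Binary.PropositionalEquality using (_≡_)
open import Data.Bool using (if_then_else_)
open import Relation.Nullary.Decidable using (⌊_⌋)

box : ℕ → List ℤ
box B = map (λ i → (+ i) ℤ.- (+ B)) (upTo (suc (B ℕ.+ B)))

countBox : (ℤ → ℤ) → ℕ → List ℕ → ℤ → ℕ
countBox f B [] m = if ⌊ m ℤ.≟ + 0 ⌋ then 1 else 0
countBox f B (a ∷ as) m =
  sum (map (λ x → countBox f B as (m ℤ.- (+ a) ℤ.* f x)) (box B))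

square : ℤ → ℤ
square x = x ℤ.* x

-- x(x-1)/2 for an integer x
tri : ℤ → ℤ
tri (+ m) = + ((m ℕ.* (m ∸ 1)) / 2)
tri -[1+ m ] = + ((suc m ℕ.* suc (suc m)) / 2)

-- N(a_1,...,a_k; n): number of integer solutions of n = Σ a_i x_i^2.
-- For positive a_i every solution has |x_i| ≤ n (x^2 ≥ |x|), so the box [-n,n]^k
-- contains all of them.
N : List ℕ → ℕ → ℕ
N as n = countBox square n as (+ n)

-- t(a_1,...,a_k; n): number of integer solutions of n = Σ a_i x_i(x_i-1)/2.
-- For positive a_i every solution has |x_i| ≤ n+1, since x(x-1)/2 ≥ |x|-1.
t : List ℕ → ℕ → ℕ
t as n = countBox tri (suc n) as (+ n)

Odd : ℕ → Set
Odd a = Σ ℕ (λ k → a ≡ suc (2 ℕ.* k))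

-- Write a = 2α + 1, b = 2β + 1 and sort the solutions of a (u² + v² + s²) + 2b w² = M by the parities of
-- u, v, s.  For even M an odd number of odd entries is impossible, so N(a,a,a,2b; M) = E + 3 O, where E counts
-- the solutions with u, v, s even and O those with u, v odd and s even.  For M = 4Q, w must be even as well and
-- E = N(a,a,a,2b; Q), while (x, y) ↦ (x + y, x - y) turns N(a,a,2a,b; 2Q) into E + O; this is the first identity.
-- For M = 16n + 14a + 2b, congruences modulo 16 force s ≡ 2 (mod 4), w odd and, up to the sign of v,
-- (u, v) = (X + 2Y, X - 2Y) with X, Y odd.  Completing the square, 8 · x(x-1)/2 + 1 = (2x - 1)², matches these
-- solutions with those counted by t(a,2a,4a,b; n), and the sign of v doubles the count: O = 2t.

module Submission where

open import Data.Nat as ℕ using (ℕ; zero; suc; z≤n; s≤s)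
import Data.Nat.Properties as ℕₚ
import Data.Nat.Tactic.RingSolver as ℕ-Solver
open import Data.Integer as ℤ using (ℤ; +_; -[1+_]; ∣_∣)
import Data.Integer.Properties as ℤₚ
open import Data.Integer.Tactic.RingSolver using (solve-∀)
open import Data.Sum using (_⊎_; inj₁; inj₂)
open import Data.Product using (_,_)
open import Relation.Nullary using (yes; no; contradiction)
open import Relation.Binary.PropositionalEquality
open import Defs

module WindowSums where

  open import Data.Integer using (_+_; _-_; -_)
  open ≡-Reasoning
  open import Data.List using (map; applyUpTo)
  open import Data.Nat.ListAction using (sum)
  open import Algebra.Properties.CommutativeSemigroup ℕₚ.+-commutativeSemigroup
    using () renaming (interchange to +-interchange)

  bit0 bit1 : ℤ → ℤ
  bit0 x = x + x
  bit1 x = x + x + + 1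

  sumFrom : ℤ → ℕ → (ℤ → ℕ) → ℕ
  sumFrom lo zero    h = 0
  sumFrom lo (suc k) h = h lo ℕ.+ sumFrom (lo + + 1) k h

  ∑ : ℕ → (ℤ → ℕ) → ℕ
  ∑ R h = sumFrom (- + R) (suc (R ℕ.+ R)) h

  Supported : ℕ → (ℤ → ℕ) → Set
  Supported S h = ∀ x → S ℕ.< ∣ x ∣ → h x ≡ 0

  sumFrom-cong : ∀ lo k {f g : ℤ → ℕ} → (∀ i → i ℕ.< k → f (lo + + i) ≡ g (lo + + i)) →
                 sumFrom lo k f ≡ sumFrom lo k g
  sumFrom-cong lo zero    eq = refl
  sumFrom-cong lo (suc k) {f} {g} eq = cong₂ ℕ._+_ head (sumFrom-cong (lo + + 1) k tail)
    where
    head : f lo ≡ g lo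
    head = subst (λ x → f x ≡ g x) (ℤₚ.+-identityʳ lo) (eq 0 (s≤s z≤n))
    tail : ∀ i → i ℕ.< k → f (lo + + 1 + + i) ≡ g (lo + + 1 + + i)
    tail i i<k = subst (λ x → f x ≡ g x) (sym (ℤₚ.+-assoc lo (+ 1) (+ i))) (eq (suc i) (s≤s i<k))

  sumFrom-zero : ∀ lo k {f : ℤ → ℕ} → (∀ i → i ℕ.< k → f (lo + + i) ≡ 0) → sumFrom lo k f ≡ 0
  sumFrom-zero lo k {f} eq = trans (sumFrom-cong lo k eq) (constant lo k)
    where
    constant : ∀ lo k → sumFrom lo k (λ _ → 0) ≡ 0
    constant lo zero    = refl
    constant lo (suc k) = constant (lo + + 1) k

  sumFrom-distrib-+ : ∀ lo k (f g : ℤ → ℕ) →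
                      sumFrom lo k (λ x → f x ℕ.+ g x) ≡ sumFrom lo k f ℕ.+ sumFrom lo k g
  sumFrom-distrib-+ lo zero    f g = refl
  sumFrom-distrib-+ lo (suc k) f g = begin
    (f lo ℕ.+ g lo) ℕ.+ sumFrom (lo + + 1) k (λ x → f x ℕ.+ g x)
      ≡⟨ cong ((f lo ℕ.+ g lo) ℕ.+_) (sumFrom-distrib-+ (lo + + 1) k f g) ⟩
    (f lo ℕ.+ g lo) ℕ.+ (sumFrom (lo + + 1) k f ℕ.+ sumFrom (lo + + 1) k g)
      ≡⟨ +-interchange (f lo) (g lo) _ _ ⟩
    (f lo ℕ.+ sumFrom (lo + + 1) k f) ℕ.+ (g lo ℕ.+ sumFrom (lo + + 1) k g) ∎

  sumFrom-comm : ∀ lo k lo′ k′ (g : ℤ → ℤ → ℕ) →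
                 sumFrom lo k (λ x → sumFrom lo′ k′ (g x)) ≡ sumFrom lo′ k′ (λ y → sumFrom lo k (λ x → g x y))
  sumFrom-comm lo zero    lo′ k′ g = sym (sumFrom-zero lo′ k′ (λ _ _ → refl))
  sumFrom-comm lo (suc k) lo′ k′ g = begin
    sumFrom lo′ k′ (g lo) ℕ.+ sumFrom (lo + + 1) k (λ x → sumFrom lo′ k′ (g x))
      ≡⟨ cong (sumFrom lo′ k′ (g lo) ℕ.+_) (sumFrom-comm (lo + + 1) k lo′ k′ g) ⟩
    sumFrom lo′ k′ (g lo) ℕ.+ sumFrom lo′ k′ (λ y → sumFrom (lo + + 1) k (λ x → g x y))
      ≡⟨ sym (sumFrom-distrib-+ lo′ k′ (g lo) _) ⟩
    sumFrom lo′ k′ (λ y → g lo y ℕ.+ sumFrom (lo + + 1) k (λ x → g x y)) ∎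

  sumFrom-++ : ∀ lo k l (h : ℤ → ℕ) → sumFrom lo (k ℕ.+ l) h ≡ sumFrom lo k h ℕ.+ sumFrom (lo + + k) l h
  sumFrom-++ lo zero    l h = cong (λ x → sumFrom x l h) (sym (ℤₚ.+-identityʳ lo))
  sumFrom-++ lo (suc k) l h = begin
    h lo ℕ.+ sumFrom (lo + + 1) (k ℕ.+ l) h
      ≡⟨ cong (h lo ℕ.+_) (sumFrom-++ (lo + + 1) k l h) ⟩
    h lo ℕ.+ (sumFrom (lo + + 1) k h ℕ.+ sumFrom (lo + + 1 + + k) l h)
      ≡⟨ cong (λ x → h lo ℕ.+ (sumFrom (lo + + 1) k h ℕ.+ sumFrom x l h)) (ℤₚ.+-assoc lo (+ 1) (+ k)) ⟩
    h lo ℕ.+ (sumFrom (lo + + 1) k h ℕ.+ sumFrom (lo + + suc k) l h)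
      ≡⟨ sym (ℕₚ.+-assoc (h lo) _ _) ⟩
    h lo ℕ.+ sumFrom (lo + + 1) k h ℕ.+ sumFrom (lo + + suc k) l h ∎

  sumFrom-shift : ∀ lo k c (h : ℤ → ℕ) → sumFrom lo k (λ x → h (x + c)) ≡ sumFrom (lo + c) k h
  sumFrom-shift lo zero    c h = refl
  sumFrom-shift lo (suc k) c h =
    cong (h (lo + c) ℕ.+_) (trans (sumFrom-shift (lo + + 1) k c h) (cong (λ x → sumFrom x k h) (shift-comm lo c)))
    where
    shift-comm : ∀ lo c → lo + + 1 + c ≡ lo + c + + 1
    shift-comm = solve-∀

  sumFrom-double : ∀ lo k (h : ℤ → ℕ) →
                   sumFrom (lo + lo) (k ℕ.+ k) h ≡ sumFrom lo k (λ x → h (bit0 x)) ℕ.+ sumFrom lo k (λ x → h (bit1 x))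
  sumFrom-double lo zero    h = refl
  sumFrom-double lo (suc k) h rewrite ℕₚ.+-suc k k = begin
    h (bit0 lo) ℕ.+ (h (bit1 lo) ℕ.+ sumFrom (bit0 lo + + 1 + + 1) (k ℕ.+ k) h)
      ≡⟨ cong (λ x → h (bit0 lo) ℕ.+ (h (bit1 lo) ℕ.+ sumFrom x (k ℕ.+ k) h)) (two-steps lo) ⟩
    h (bit0 lo) ℕ.+ (h (bit1 lo) ℕ.+ sumFrom (lo′ + lo′) (k ℕ.+ k) h)
      ≡⟨ cong (λ x → h (bit0 lo) ℕ.+ (h (bit1 lo) ℕ.+ x)) (sumFrom-double lo′ k h) ⟩
    h (bit0 lo) ℕ.+ (h (bit1 lo) ℕ.+ (sumFrom lo′ k (λ x → h (bit0 x)) ℕ.+ sumFrom lo′ k (λ x → h (bit1 x))))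
      ≡⟨ regroup (h (bit0 lo)) (h (bit1 lo)) _ _ ⟩
    (h (bit0 lo) ℕ.+ sumFrom lo′ k (λ x → h (bit0 x))) ℕ.+ (h (bit1 lo) ℕ.+ sumFrom lo′ k (λ x → h (bit1 x))) ∎
    where
    regroup : ∀ a b c d → a ℕ.+ (b ℕ.+ (c ℕ.+ d)) ≡ (a ℕ.+ c) ℕ.+ (b ℕ.+ d)
    regroup = ℕ-Solver.solve-∀
    lo′ : ℤ
    lo′ = lo + + 1
    two-steps : ∀ lo → lo + lo + + 1 + + 1 ≡ (lo + + 1) + (lo + + 1)
    two-steps = solve-∀

  ∑-cong : ∀ R {f g : ℤ → ℕ} → (∀ x → f x ≡ g x) → ∑ R f ≡ ∑ R g
  ∑-cong R eq = sumFrom-cong (- + R) (suc (R ℕ.+ R)) (λ i _ → eq _)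

  ∑-cong-≤ : ∀ R {f g : ℤ → ℕ} → (∀ x → ∣ x ∣ ℕ.≤ R → f x ≡ g x) → ∑ R f ≡ ∑ R g
  ∑-cong-≤ R eq = sumFrom-cong (- + R) (suc (R ℕ.+ R)) (λ i i<2R+1 → eq _ (in-window i i<2R+1))
    where
    in-window : ∀ i → i ℕ.< suc (R ℕ.+ R) → ∣ - + R + + i ∣ ℕ.≤ R
    in-window i (s≤s i≤2R) rewrite ℤₚ.-m+n≡n⊖m R i with ℕₚ.≤-total i R
    ... | inj₁ i≤R = ℕₚ.≤-trans (ℕₚ.≤-reflexive (ℤₚ.∣⊖∣-≤ i≤R)) (ℕₚ.m∸n≤m R i)
    ... | inj₂ R≤i = ℕₚ.≤-trans (ℕₚ.≤-reflexive (trans (ℤₚ.∣m⊖n∣≡∣n⊖m∣ i R) (ℤₚ.∣⊖∣-≤ R≤i)))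
                                (ℕₚ.m≤n+o⇒m∸n≤o i R i≤2R)

  ∑-zero : ∀ R {f : ℤ → ℕ} → (∀ x → f x ≡ 0) → ∑ R f ≡ 0
  ∑-zero R eq = sumFrom-zero (- + R) (suc (R ℕ.+ R)) (λ _ _ → eq _)

  ∑-distrib-+ : ∀ R (f g : ℤ → ℕ) → ∑ R (λ x → f x ℕ.+ g x) ≡ ∑ R f ℕ.+ ∑ R g
  ∑-distrib-+ R = sumFrom-distrib-+ (- + R) (suc (R ℕ.+ R))

  ∑-comm : ∀ R S (g : ℤ → ℤ → ℕ) → ∑ R (λ x → ∑ S (g x)) ≡ ∑ S (λ y → ∑ R (λ x → g x y))
  ∑-comm R S = sumFrom-comm (- + R) (suc (R ℕ.+ R)) (- + S) (suc (S ℕ.+ S))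

  sum-box : ∀ B (h : ℤ → ℕ) → sum (map h (box B)) ≡ ∑ B h
  sum-box B h = unfold (suc (B ℕ.+ B)) (λ i → i) (- + B) (λ i → ℤₚ.+-comm (+ i) (- + B))
    where
    unfold : ∀ k (f : ℕ → ℕ) lo → (∀ i → + f i - + B ≡ lo + + i) →
         sum (map h (map (λ i → + i - + B) (applyUpTo f k))) ≡ sumFrom lo k h
    unfold zero    f lo eq = refl
    unfold (suc k) f lo eq = cong₂ ℕ._+_ (cong h (trans (eq 0) (ℤₚ.+-identityʳ lo)))
      (unfold k (λ i → f (suc i)) (lo + + 1) (λ i → trans (eq (suc i)) (sym (ℤₚ.+-assoc lo (+ 1) (+ i)))))

  sumFrom-window : ∀ S (h : ℤ → ℕ) → Supported S h → ∀ d f →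
                   sumFrom (- + (d ℕ.+ S)) (d ℕ.+ (suc (S ℕ.+ S) ℕ.+ f)) h ≡ ∑ S h
  sumFrom-window S h supp zero f = begin
    sumFrom (- + S) (suc (S ℕ.+ S) ℕ.+ f) h
      ≡⟨ sumFrom-++ (- + S) (suc (S ℕ.+ S)) f h ⟩
    ∑ S h ℕ.+ sumFrom (- + S + + suc (S ℕ.+ S)) f h
      ≡⟨ cong (∑ S h ℕ.+_) (sumFrom-zero _ f beyond) ⟩
    ∑ S h ℕ.+ 0
      ≡⟨ ℕₚ.+-identityʳ _ ⟩
    ∑ S h ∎
    where
    top : - + S + + suc (S ℕ.+ S) ≡ + suc S
    top = trans (ℤₚ.-m+n≡n⊖m S (suc (S ℕ.+ S)))
                (trans (ℤₚ.⊖-≥ (ℕₚ.≤-trans (ℕₚ.m≤m+n S S) (ℕₚ.n≤1+n _)))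
                       (cong +_ (trans (cong (ℕ._∸ S) (sym (ℕₚ.+-suc S S))) (ℕₚ.m+n∸m≡n S (suc S)))))
    beyond : ∀ i → i ℕ.< f → h (- + S + + suc (S ℕ.+ S) + + i) ≡ 0
    beyond i _ rewrite top = supp (+ suc (S ℕ.+ i)) (s≤s (ℕₚ.m≤m+n S i))
  sumFrom-window S h supp (suc d) f = begin
    h (- + suc (d ℕ.+ S)) ℕ.+ sumFrom (- + suc (d ℕ.+ S) + + 1) (d ℕ.+ (suc (S ℕ.+ S) ℕ.+ f)) h
      ≡⟨ cong₂ ℕ._+_ (supp _ (s≤s (ℕₚ.m≤n+m S d)))
                     (cong (λ x → sumFrom x (d ℕ.+ (suc (S ℕ.+ S) ℕ.+ f)) h) (step (d ℕ.+ S))) ⟩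
    sumFrom (- + (d ℕ.+ S)) (d ℕ.+ (suc (S ℕ.+ S) ℕ.+ f)) h
      ≡⟨ sumFrom-window S h supp d f ⟩
    ∑ S h ∎
    where
    step : ∀ n → - + suc n + + 1 ≡ - + n
    step zero    = refl
    step (suc n) = refl

  ∑-enlarge : ∀ S R (h : ℤ → ℕ) → Supported S h → S ℕ.≤ R → ∑ R h ≡ ∑ S h
  ∑-enlarge S R h supp S≤R with ℕₚ.m≤n⇒∃[o]m+o≡n S≤R
  ... | d , refl = trans (cong₂ (λ lo k → sumFrom (- + lo) k h) (ℕₚ.+-comm S d) (length S d))
                         (sumFrom-window S h supp d d)
    where
    length : ∀ S d → suc (S ℕ.+ d ℕ.+ (S ℕ.+ d)) ≡ d ℕ.+ (suc (S ℕ.+ S) ℕ.+ d)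
    length = ℕ-Solver.solve-∀

  ∑-shift : ∀ S R c (h : ℤ → ℕ) → Supported S h → S ℕ.+ ∣ c ∣ ℕ.≤ R → ∑ R (λ x → h (x + c)) ≡ ∑ S h
  ∑-shift S R c h supp bound = trans (sumFrom-shift (- + R) (suc (R ℕ.+ R)) c h) (shifted c bound)
    where
    shifted : ∀ c → S ℕ.+ ∣ c ∣ ℕ.≤ R → sumFrom (- + R + c) (suc (R ℕ.+ R)) h ≡ ∑ S h
    shifted (+ p) bound with ℕₚ.m≤n⇒∃[o]m+o≡n bound
    ... | d , refl = trans (cong₂ (λ lo k → sumFrom lo k h) start (length S p d))
                           (sumFrom-window S h supp d (p ℕ.+ p ℕ.+ d))
      where
      start : - + (S ℕ.+ p ℕ.+ d) + + p ≡ - + (d ℕ.+ S)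
      start rewrite ℤₚ.pos-+ (S ℕ.+ p) d | ℤₚ.pos-+ S p | ℤₚ.pos-+ d S = rearrange (+ S) (+ p) (+ d)
        where
        rearrange : ∀ s p d → - (s + p + d) + p ≡ - (d + s)
        rearrange = solve-∀
      length : ∀ S p d → suc (S ℕ.+ p ℕ.+ d ℕ.+ (S ℕ.+ p ℕ.+ d)) ≡ d ℕ.+ (suc (S ℕ.+ S) ℕ.+ (p ℕ.+ p ℕ.+ d))
      length = ℕ-Solver.solve-∀
    shifted -[1+ p ] bound with ℕₚ.m≤n⇒∃[o]m+o≡n bound
    ... | d , refl = trans (cong₂ (λ lo k → sumFrom lo k h) start (length S p d))
                           (sumFrom-window S h supp (suc p ℕ.+ suc p ℕ.+ d) d)
      where
      start : - + (S ℕ.+ suc p ℕ.+ d) + -[1+ p ] ≡ - + (suc p ℕ.+ suc p ℕ.+ d ℕ.+ S)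
      start rewrite ℤₚ.pos-+ (S ℕ.+ suc p) d | ℤₚ.pos-+ S (suc p) | ℤₚ.pos-+ (suc p ℕ.+ suc p ℕ.+ d) S
                  | ℤₚ.pos-+ (suc p ℕ.+ suc p) d | ℤₚ.pos-+ (suc p) (suc p) = rearrange (+ S) (+ suc p) (+ d)
        where
        rearrange : ∀ s p d → - (s + p + d) + - p ≡ - (p + p + d + s)
        rearrange = solve-∀
      length : ∀ S p d → suc (S ℕ.+ suc p ℕ.+ d ℕ.+ (S ℕ.+ suc p ℕ.+ d)) ≡ suc p ℕ.+ suc p ℕ.+ d ℕ.+ (suc (S ℕ.+ S) ℕ.+ d)
      length = ℕ-Solver.solve-∀

  ∑-parity : ∀ S R (h : ℤ → ℕ) → Supported S h → S ℕ.≤ R →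
             ∑ S h ≡ ∑ R (λ x → h (bit0 x)) ℕ.+ ∑ R (λ x → h (bit1 x))
  ∑-parity S R h supp S≤R with ℕₚ.m≤n⇒∃[o]m+o≡n S≤R
  ... | d , refl = begin
    ∑ S h
      ≡⟨ sumFrom-window S h supp (d ℕ.+ d ℕ.+ S) (S ℕ.+ d ℕ.+ d ℕ.+ 1) ⟨
    sumFrom (- + (d ℕ.+ d ℕ.+ S ℕ.+ S)) (d ℕ.+ d ℕ.+ S ℕ.+ (suc (S ℕ.+ S) ℕ.+ (S ℕ.+ d ℕ.+ d ℕ.+ 1))) h
      ≡⟨ cong₂ (λ lo k → sumFrom lo k h) start (length S d) ⟨
    sumFrom (- + R + - + R) (suc (R ℕ.+ R) ℕ.+ suc (R ℕ.+ R)) h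
      ≡⟨ sumFrom-double (- + R) (suc (R ℕ.+ R)) h ⟩
    ∑ R (λ x → h (bit0 x)) ℕ.+ ∑ R (λ x → h (bit1 x)) ∎
    where
    start : - + R + - + R ≡ - + (d ℕ.+ d ℕ.+ S ℕ.+ S)
    start rewrite ℤₚ.pos-+ S d | ℤₚ.pos-+ (d ℕ.+ d ℕ.+ S) S | ℤₚ.pos-+ (d ℕ.+ d) S | ℤₚ.pos-+ d d = rearrange (+ S) (+ d)
      where
      rearrange : ∀ s d → - (s + d) + - (s + d) ≡ - (d + d + s + s)
      rearrange = solve-∀
    length : ∀ S d → suc (S ℕ.+ d ℕ.+ (S ℕ.+ d)) ℕ.+ suc (S ℕ.+ d ℕ.+ (S ℕ.+ d))
                     ≡ d ℕ.+ d ℕ.+ S ℕ.+ (suc (S ℕ.+ S) ℕ.+ (S ℕ.+ d ℕ.+ d ℕ.+ 1))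
    length = ℕ-Solver.solve-∀

module MultipleSums where

  open import Data.Integer using (_+_; _-_; -_)
  open WindowSums

  ∣bit0∣ : ∀ x → ∣ bit0 x ∣ ≡ ∣ x ∣ ℕ.+ ∣ x ∣
  ∣bit0∣ x = trans (cong ∣_∣ (twice x)) (trans (ℤₚ.abs-* (+ 2) x) (cong (∣ x ∣ ℕ.+_) (ℕₚ.+-identityʳ ∣ x ∣)))
    where
    twice : ∀ x → x + x ≡ + 2 ℤ.* x
    twice = solve-∀

  bit0-grows : ∀ {S} x → S ℕ.< ∣ x ∣ → S ℕ.< ∣ bit0 x ∣
  bit0-grows x S<∣x∣ rewrite ∣bit0∣ x = ℕₚ.<-≤-trans S<∣x∣ (ℕₚ.m≤m+n _ _)

  bit1-grows : ∀ {S} x → S ℕ.< ∣ x ∣ → S ℕ.< ∣ bit1 x ∣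
  bit1-grows {S} x S<∣x∣ = ℕₚ.+-cancelʳ-≤ 1 (suc S) ∣ bit1 x ∣ (begin
    suc S ℕ.+ 1          ≤⟨ ℕₚ.+-mono-≤ S<∣x∣ (ℕₚ.≤-trans (s≤s z≤n) S<∣x∣) ⟩
    ∣ x ∣ ℕ.+ ∣ x ∣      ≡⟨ ∣bit0∣ x ⟨
    ∣ bit0 x ∣           ≡⟨ cong ∣_∣ (predecessor x) ⟩
    ∣ bit1 x - + 1 ∣     ≤⟨ ℤₚ.∣i-j∣≤∣i∣+∣j∣ (bit1 x) (+ 1) ⟩
    ∣ bit1 x ∣ ℕ.+ 1     ∎)
    where
    open ℕₚ.≤-Reasoning
    predecessor : ∀ x → x + x ≡ x + x + + 1 - + 1
    predecessor = solve-∀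

  apart : ∀ {S} p q y → ∣ bit0 y ∣ ℕ.≤ ∣ p ∣ ℕ.+ ∣ q ∣ → S ℕ.< ∣ y ∣ → S ℕ.< ∣ p ∣ ⊎ S ℕ.< ∣ q ∣
  apart {S} p q y 2y≤ S<∣y∣ with S ℕ.<? ∣ p ∣ | S ℕ.<? ∣ q ∣
  ... | yes S<∣p∣ | _         = inj₁ S<∣p∣
  ... | no _      | yes S<∣q∣ = inj₂ S<∣q∣
  ... | no S≮∣p∣  | no S≮∣q∣  = contradiction (begin-strict
    S ℕ.+ S              <⟨ ℕₚ.+-mono-< S<∣y∣ S<∣y∣ ⟩
    ∣ y ∣ ℕ.+ ∣ y ∣      ≡⟨ ∣bit0∣ y ⟨
    ∣ bit0 y ∣           ≤⟨ 2y≤ ⟩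
    ∣ p ∣ ℕ.+ ∣ q ∣      ≤⟨ ℕₚ.+-mono-≤ (ℕₚ.≮⇒≥ S≮∣p∣) (ℕₚ.≮⇒≥ S≮∣q∣) ⟩
    S ℕ.+ S              ∎) (ℕₚ.<-irrefl refl)
    where open ℕₚ.≤-Reasoning

  apart-by-difference : ∀ {S} p q y → p - q ≡ bit0 y → S ℕ.< ∣ y ∣ → S ℕ.< ∣ p ∣ ⊎ S ℕ.< ∣ q ∣
  apart-by-difference p q y eq =
    apart p q y (subst (λ z → ∣ z ∣ ℕ.≤ ∣ p ∣ ℕ.+ ∣ q ∣) eq (ℤₚ.∣i-j∣≤∣i∣+∣j∣ p q))

  apart-by-sum : ∀ {S} p q y → p + q ≡ bit0 y → S ℕ.< ∣ y ∣ → S ℕ.< ∣ p ∣ ⊎ S ℕ.< ∣ q ∣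
  apart-by-sum p q y eq =
    apart p q y (subst (λ z → ∣ z ∣ ℕ.≤ ∣ p ∣ ℕ.+ ∣ q ∣) eq (ℤₚ.∣i+j∣≤∣i∣+∣j∣ p q))

  ∑-translate : ∀ S c (h : ℤ → ℕ) → Supported S h → Supported S (λ x → h (x + c)) → ∣ c ∣ ℕ.≤ S →
                ∑ S (λ x → h (x + c)) ≡ ∑ S h
  ∑-translate S c h supp supp+c ∣c∣≤S =
    trans (sym (∑-enlarge S (S ℕ.+ S) (λ x → h (x + c)) supp+c (ℕₚ.m≤m+n S S)))
          (∑-shift S (S ℕ.+ S) c h supp (ℕₚ.+-monoʳ-≤ S ∣c∣≤S))

  ∑² : ℕ → (ℤ → ℤ → ℕ) → ℕ
  ∑² S F = ∑ S (λ x → ∑ S (F x))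

  ∑³ : ℕ → (ℤ → ℤ → ℤ → ℕ) → ℕ
  ∑³ S G = ∑ S (λ x → ∑² S (G x))

  ∑⁴ : ℕ → (ℤ → ℤ → ℤ → ℤ → ℕ) → ℕ
  ∑⁴ S g = ∑ S (λ x → ∑³ S (g x))

  Supported² : ℕ → (ℤ → ℤ → ℕ) → Set
  Supported² S F = ∀ x y → S ℕ.< ∣ x ∣ ⊎ S ℕ.< ∣ y ∣ → F x y ≡ 0

  Supported³ : ℕ → (ℤ → ℤ → ℤ → ℕ) → Set
  Supported³ S G = ∀ x y z → S ℕ.< ∣ x ∣ ⊎ S ℕ.< ∣ y ∣ ⊎ S ℕ.< ∣ z ∣ → G x y z ≡ 0

  Supported⁴ : ℕ → (ℤ → ℤ → ℤ → ℤ → ℕ) → Set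
  Supported⁴ S g = ∀ x y z w → S ℕ.< ∣ x ∣ ⊎ S ℕ.< ∣ y ∣ ⊎ S ℕ.< ∣ z ∣ ⊎ S ℕ.< ∣ w ∣ → g x y z w ≡ 0

  ∑³-cong : ∀ S {G G′ : ℤ → ℤ → ℤ → ℕ} → (∀ x y z → G x y z ≡ G′ x y z) → ∑³ S G ≡ ∑³ S G′
  ∑³-cong S eq = ∑-cong S λ x → ∑-cong S λ y → ∑-cong S λ z → eq x y z

  ∑⁴-cong : ∀ S {g g′ : ℤ → ℤ → ℤ → ℤ → ℕ} → (∀ x y z w → g x y z w ≡ g′ x y z w) →
            ∑⁴ S g ≡ ∑⁴ S g′
  ∑⁴-cong S eq = ∑³-cong S λ x y z → ∑-cong S λ w → eq x y z w

  ∑³-zero : ∀ S {G : ℤ → ℤ → ℤ → ℕ} → (∀ x y z → G x y z ≡ 0) → ∑³ S G ≡ 0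
  ∑³-zero S eq = ∑-zero S λ x → ∑-zero S λ y → ∑-zero S λ z → eq x y z

  -- (x, y) ↦ (x + y, x - y) is a bijection of ℤ² onto the pairs of equal parity.
  ∑²-rotate : ∀ S (F : ℤ → ℤ → ℕ) → Supported² S F →
              ∑² S (λ x y → F (x + y) (x - y)) ≡ ∑² S (λ m n → F (bit0 m) (bit0 n)) ℕ.+ ∑² S (λ m n → F (bit1 m) (bit1 n))
  ∑²-rotate S F supp = begin
    ∑ S (λ x → ∑ S (λ y → F (x + y) (x - y)))
      ≡⟨ ∑-comm S S _ ⟩
    ∑ S (λ y → ∑ S (λ x → F (x + y) (x - y)))
      ≡⟨ ∑-cong-≤ S (λ y ∣y∣≤S → trans (∑-cong S (λ x → cong (λ u → F u (x - y)) (recentre x y)))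
                                        (∑-translate S (- y) (λ t → F (t + bit0 y) t)
                                           (λ t S<∣t∣ → supp _ t (inj₂ S<∣t∣))
                                           (λ x S<∣x∣ → supp _ _ (apart-by-sum (x + - y + bit0 y) (x + - y) x (rotated x y) S<∣x∣))
                                           (ℕₚ.≤-trans (ℕₚ.≤-reflexive (ℤₚ.∣-i∣≡∣i∣ y)) ∣y∣≤S))) ⟩
    ∑ S (λ y → ∑ S (λ t → F (t + bit0 y) t))
      ≡⟨ ∑-comm S S _ ⟩
    ∑ S (λ t → ∑ S (λ y → F (t + bit0 y) t))
      ≡⟨ ∑-parity S S _ (λ t S<∣t∣ → ∑-zero S (λ y → supp _ t (inj₂ S<∣t∣))) ℕₚ.≤-refl ⟩
    ∑ S (λ m → ∑ S (λ y → F (bit0 m + bit0 y) (bit0 m))) ℕ.+ ∑ S (λ m → ∑ S (λ y → F (bit1 m + bit0 y) (bit1 m)))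
      ≡⟨ cong₂ ℕ._+_ (∑-cong-≤ S (λ m ∣m∣≤S → diagonal bit0 m (even-step m) ∣m∣≤S bit0-grows))
                     (∑-cong-≤ S (λ m ∣m∣≤S → diagonal bit1 m (odd-step m) ∣m∣≤S bit1-grows)) ⟩
    ∑ S (λ m → ∑ S (λ n → F (bit0 n) (bit0 m))) ℕ.+ ∑ S (λ m → ∑ S (λ n → F (bit1 n) (bit1 m)))
      ≡⟨ cong₂ ℕ._+_ (∑-comm S S (λ m n → F (bit0 n) (bit0 m))) (∑-comm S S (λ m n → F (bit1 n) (bit1 m))) ⟩
    ∑ S (λ m → ∑ S (λ n → F (bit0 m) (bit0 n))) ℕ.+ ∑ S (λ m → ∑ S (λ n → F (bit1 m) (bit1 n))) ∎
    where
    open ≡-Reasoning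
    recentre : ∀ x y → x + y ≡ x + - y + (y + y)
    recentre = solve-∀
    rotated : ∀ x y → x + - y + (y + y) + (x + - y) ≡ x + x
    rotated = solve-∀
    even-step : ∀ m y → m + m + (y + y) ≡ (y + m) + (y + m)
    even-step = solve-∀
    odd-step : ∀ m y → m + m + + 1 + (y + y) ≡ (y + m) + (y + m) + + 1
    odd-step = solve-∀
    cancel : ∀ a y → a + (y + y) - a ≡ y + y
    cancel = solve-∀
    diagonal : ∀ (b : ℤ → ℤ) m → (∀ y → b m + bit0 y ≡ b (y + m)) → ∣ m ∣ ℕ.≤ S →
               (∀ x → S ℕ.< ∣ x ∣ → S ℕ.< ∣ b x ∣) →
               ∑ S (λ y → F (b m + bit0 y) (b m)) ≡ ∑ S (λ n → F (b n) (b m))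
    diagonal b m step ∣m∣≤S grows = trans (∑-cong S (λ y → cong (λ u → F u (b m)) (step y)))
      (∑-translate S m (λ n → F (b n) (b m)) (λ n S<∣n∣ → supp _ _ (inj₁ (grows n S<∣n∣)))
         (λ y S<∣y∣ → supp _ _ (apart-by-difference (b (y + m)) (b m) y
                                 (trans (cong (_- b m) (sym (step y))) (cancel (b m) y)) S<∣y∣))
         ∣m∣≤S)

  ∑²-parity : ∀ S (F : ℤ → ℤ → ℕ) → Supported² S F →
              ∑² S F ≡ ∑² S (λ x y → F (bit0 x) (bit0 y)) ℕ.+ ∑² S (λ x y → F (bit0 x) (bit1 y))
                       ℕ.+ ∑² S (λ x y → F (bit1 x) (bit0 y)) ℕ.+ ∑² S (λ x y → F (bit1 x) (bit1 y))
  ∑²-parity S F supp = begin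
    ∑² S F
      ≡⟨ ∑-parity S S _ (λ x S<∣x∣ → ∑-zero S (λ y → supp x y (inj₁ S<∣x∣))) ℕₚ.≤-refl ⟩
    ∑ S (λ x → ∑ S (F (bit0 x))) ℕ.+ ∑ S (λ x → ∑ S (F (bit1 x)))
      ≡⟨ cong₂ ℕ._+_ (second bit0) (second bit1) ⟩
    (∑² S (λ x y → F (bit0 x) (bit0 y)) ℕ.+ ∑² S (λ x y → F (bit0 x) (bit1 y)))
      ℕ.+ (∑² S (λ x y → F (bit1 x) (bit0 y)) ℕ.+ ∑² S (λ x y → F (bit1 x) (bit1 y)))
      ≡⟨ ℕₚ.+-assoc (∑² S (λ x y → F (bit0 x) (bit0 y)) ℕ.+ ∑² S (λ x y → F (bit0 x) (bit1 y))) _ _ ⟨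
    ∑² S (λ x y → F (bit0 x) (bit0 y)) ℕ.+ ∑² S (λ x y → F (bit0 x) (bit1 y))
      ℕ.+ ∑² S (λ x y → F (bit1 x) (bit0 y)) ℕ.+ ∑² S (λ x y → F (bit1 x) (bit1 y)) ∎
    where
    open ≡-Reasoning
    second : ∀ (b : ℤ → ℤ) →
             ∑ S (λ x → ∑ S (F (b x))) ≡ ∑² S (λ x y → F (b x) (bit0 y)) ℕ.+ ∑² S (λ x y → F (b x) (bit1 y))
    second b = trans (∑-cong S (λ x → ∑-parity S S (F (b x)) (λ y S<∣y∣ → supp (b x) y (inj₂ S<∣y∣)) ℕₚ.≤-refl))
                     (∑-distrib-+ S (λ x → ∑ S (λ y → F (b x) (bit0 y))) (λ x → ∑ S (λ y → F (b x) (bit1 y))))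

  ∑³-parity : ∀ S (G : ℤ → ℤ → ℤ → ℕ) → Supported³ S G →
    ∑³ S G ≡ (∑³ S (λ x y z → G (bit0 x) (bit0 y) (bit0 z)) ℕ.+ ∑³ S (λ x y z → G (bit0 x) (bit0 y) (bit1 z))
              ℕ.+ ∑³ S (λ x y z → G (bit0 x) (bit1 y) (bit0 z)) ℕ.+ ∑³ S (λ x y z → G (bit0 x) (bit1 y) (bit1 z)))
             ℕ.+ (∑³ S (λ x y z → G (bit1 x) (bit0 y) (bit0 z)) ℕ.+ ∑³ S (λ x y z → G (bit1 x) (bit0 y) (bit1 z))
              ℕ.+ ∑³ S (λ x y z → G (bit1 x) (bit1 y) (bit0 z)) ℕ.+ ∑³ S (λ x y z → G (bit1 x) (bit1 y) (bit1 z)))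
  ∑³-parity S G supp =
    trans (∑-parity S S _ (λ x S<∣x∣ → ∑-zero S (λ y → ∑-zero S (λ z → supp x y z (inj₁ S<∣x∣)))) ℕₚ.≤-refl)
          (cong₂ ℕ._+_ (inner bit0) (inner bit1))
    where
    distrib₄ : ∀ (f₁ f₂ f₃ f₄ : ℤ → ℕ) →
               ∑ S (λ x → f₁ x ℕ.+ f₂ x ℕ.+ f₃ x ℕ.+ f₄ x) ≡ ∑ S f₁ ℕ.+ ∑ S f₂ ℕ.+ ∑ S f₃ ℕ.+ ∑ S f₄
    distrib₄ f₁ f₂ f₃ f₄ =
      trans (∑-distrib-+ S (λ x → f₁ x ℕ.+ f₂ x ℕ.+ f₃ x) f₄) (cong (ℕ._+ ∑ S f₄)
      (trans (∑-distrib-+ S (λ x → f₁ x ℕ.+ f₂ x) f₃) (cong (ℕ._+ ∑ S f₃) (∑-distrib-+ S f₁ f₂))))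
    inner : ∀ (b : ℤ → ℤ) → ∑ S (λ x → ∑² S (G (b x)))
            ≡ ∑³ S (λ x y z → G (b x) (bit0 y) (bit0 z)) ℕ.+ ∑³ S (λ x y z → G (b x) (bit0 y) (bit1 z))
              ℕ.+ ∑³ S (λ x y z → G (b x) (bit1 y) (bit0 z)) ℕ.+ ∑³ S (λ x y z → G (b x) (bit1 y) (bit1 z))
    inner b = trans (∑-cong S (λ x → ∑²-parity S (G (b x)) (λ y z → λ
                      { (inj₁ S<∣y∣) → supp (b x) y z (inj₂ (inj₁ S<∣y∣))
                      ; (inj₂ S<∣z∣) → supp (b x) y z (inj₂ (inj₂ S<∣z∣)) })))
                    (distrib₄ (λ x → ∑² S (λ y z → G (b x) (bit0 y) (bit0 z))) (λ x → ∑² S (λ y z → G (b x) (bit0 y) (bit1 z)))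
                              (λ x → ∑² S (λ y z → G (b x) (bit1 y) (bit0 z))) (λ x → ∑² S (λ y z → G (b x) (bit1 y) (bit1 z))))

  ∑³-swap₂₃ : ∀ S (G : ℤ → ℤ → ℤ → ℕ) → ∑³ S (λ x y z → G x z y) ≡ ∑³ S G
  ∑³-swap₂₃ S G = ∑-cong S (λ x → ∑-comm S S (λ y z → G x z y))

  ∑³-cycle : ∀ S (G : ℤ → ℤ → ℤ → ℕ) → ∑³ S (λ x y z → G y z x) ≡ ∑³ S G
  ∑³-cycle S G = trans (∑-comm S S (λ x y → ∑ S (λ z → G y z x)))
                       (∑-cong S (λ y → ∑-comm S S (λ x z → G y z x)))

  ∑⁴-enlarge : ∀ S R (g : ℤ → ℤ → ℤ → ℤ → ℕ) → Supported⁴ S g → S ℕ.≤ R → ∑⁴ R g ≡ ∑⁴ S g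
  ∑⁴-enlarge S R g supp S≤R =
    trans (∑-cong R λ x → trans (∑-cong R λ y → trans (∑-cong R λ z →
            ∑-enlarge S R (g x y z) (λ w out → supp x y z w (inj₂ (inj₂ (inj₂ out)))) S≤R)
          (∑-enlarge S R (λ z → ∑ S (g x y z))
                     (λ z out → ∑-zero S λ w → supp x y z w (inj₂ (inj₂ (inj₁ out)))) S≤R))
          (∑-enlarge S R (λ y → ∑² S (g x y))
                     (λ y out → ∑-zero S λ z → ∑-zero S λ w → supp x y z w (inj₂ (inj₁ out))) S≤R))
          (∑-enlarge S R (λ x → ∑³ S (g x))
                     (λ x out → ∑-zero S λ y → ∑-zero S λ z → ∑-zero S λ w → supp x y z w (inj₁ out)) S≤R)

  ∑⁴-shift : ∀ S R c (g : ℤ → ℤ → ℤ → ℤ → ℕ) → Supported⁴ S g → S ℕ.+ ∣ c ∣ ℕ.≤ R →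
             ∑⁴ R (λ x y z w → g (x + c) (y + c) (z + c) (w + c)) ≡ ∑⁴ S g
  ∑⁴-shift S R c g supp bound =
    trans (∑-cong R λ x → trans (∑-cong R λ y → trans (∑-cong R λ z →
            ∑-shift S R c (g (x + c) (y + c) (z + c)) (λ w out → supp _ _ _ w (inj₂ (inj₂ (inj₂ out)))) bound)
          (∑-shift S R c (λ z → ∑ S (g (x + c) (y + c) z))
                   (λ z out → ∑-zero S λ w → supp _ _ z w (inj₂ (inj₂ (inj₁ out)))) bound))
          (∑-shift S R c (λ y → ∑² S (g (x + c) y))
                   (λ y out → ∑-zero S λ z → ∑-zero S λ w → supp _ y z w (inj₂ (inj₁ out))) bound))
          (∑-shift S R c (λ x → ∑³ S (g x))
                   (λ x out → ∑-zero S λ y → ∑-zero S λ z → ∑-zero S λ w → supp x y z w (inj₁ out)) bound)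

module Indicators where

  open import Data.Integer using (_+_; _-_; -_; _*_)
  open import Data.Nat using (NonZero)
  open import Data.Bool using (if_then_else_)
  open import Data.Sum using ([_,_]′)
  open import Data.Empty using (⊥)
  open import Data.List using ([]; _∷_)
  open import Relation.Nullary.Decidable using (⌊_⌋)
  open WindowSums
  open MultipleSums

  -- Agrees definitionally with the base case of countBox.
  χ₀ : ℤ → ℕ
  χ₀ z = if ⌊ z ℤ.≟ + 0 ⌋ then 1 else 0

  χ₀-≢0 : ∀ {z} → z ≢ + 0 → χ₀ z ≡ 0
  χ₀-≢0 {z} z≢0 with z ℤ.≟ + 0
  ... | yes z≡0 = contradiction z≡0 z≢0
  ... | no _    = refl

  χ₀≢0⇒≡0 : ∀ z → χ₀ z ≢ 0 → z ≡ + 0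
  χ₀≢0⇒≡0 z χ₀z≢0 with z ℤ.≟ + 0
  ... | yes z≡0 = z≡0
  ... | no _    = contradiction refl χ₀z≢0

  χ₀-*-cancel : ∀ c z → c ≢ + 0 → χ₀ (c * z) ≡ χ₀ z
  χ₀-*-cancel c z c≢0 with z ℤ.≟ + 0
  ... | yes refl = cong χ₀ (ℤₚ.*-zeroʳ c)
  ... | no z≢0   = χ₀-≢0 (λ cz≡0 → [ c≢0 , z≢0 ]′ (ℤₚ.i*j≡0⇒i≡0∨j≡0 c cz≡0))

  k*x+r≢0 : ∀ k r x → 0 ℕ.< r → r ℕ.< k → + k * x + + r ≢ + 0
  k*x+r≢0 k r x 0<r r<k eq = impossible ∣ x ∣ r≡k*∣x∣
    where
    solve-for-r : ∀ K X R → R ≡ (K * X + R) + K * - X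
    solve-for-r = solve-∀
    r≡k*∣x∣ : r ≡ k ℕ.* ∣ x ∣
    r≡k*∣x∣ = begin
      ∣ + r ∣                        ≡⟨ cong ∣_∣ (solve-for-r (+ k) x (+ r)) ⟩
      ∣ (+ k * x + + r) + + k * - x ∣ ≡⟨ cong (λ z → ∣ z + + k * - x ∣) eq ⟩
      ∣ + 0 + + k * - x ∣            ≡⟨ cong ∣_∣ (ℤₚ.+-identityˡ (+ k * - x)) ⟩
      ∣ + k * - x ∣                  ≡⟨ ℤₚ.abs-* (+ k) (- x) ⟩
      k ℕ.* ∣ - x ∣                  ≡⟨ cong (k ℕ.*_) (ℤₚ.∣-i∣≡∣i∣ x) ⟩
      k ℕ.* ∣ x ∣                    ∎
      where open ≡-Reasoning
    impossible : ∀ n → r ≡ k ℕ.* n → ⊥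
    impossible zero    r≡ = ℕₚ.<-irrefl refl (subst (0 ℕ.<_) (trans r≡ (ℕₚ.*-zeroʳ k)) 0<r)
    impossible (suc n) r≡ = ℕₚ.<⇒≱ r<k (subst (k ℕ.≤_) (sym r≡) (ℕₚ.m≤m*n k (suc n)))

  χ₀-residue : ∀ k r x → 0 ℕ.< r → r ℕ.< k → χ₀ (+ k * x + + r) ≡ 0
  χ₀-residue k r x 0<r r<k = χ₀-≢0 (k*x+r≢0 k r x 0<r r<k)

  weighted : ℕ → ℕ → ℕ → ℕ → (ℤ → ℤ) → ℤ → ℤ → ℤ → ℤ → ℤ
  weighted c₁ c₂ c₃ c₄ f x y z w = + c₁ * f x + + c₂ * f y + + c₃ * f z + + c₄ * f w

  weighted-cong : ∀ {c₁ c₂ c₃ c₄ C₁ C₂ C₃ C₄} f x y z w →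
                  + c₁ ≡ C₁ → + c₂ ≡ C₂ → + c₃ ≡ C₃ → + c₄ ≡ C₄ →
                  weighted c₁ c₂ c₃ c₄ f x y z w ≡ C₁ * f x + C₂ * f y + C₃ * f z + C₄ * f w
  weighted-cong f x y z w refl refl refl refl = refl

  countBox-∑⁴ : ∀ f B c₁ c₂ c₃ c₄ m →
                countBox f B (c₁ ∷ c₂ ∷ c₃ ∷ c₄ ∷ []) m
                ≡ ∑⁴ B (λ x y z w → χ₀ (m - weighted c₁ c₂ c₃ c₄ f x y z w))
  countBox-∑⁴ f B c₁ c₂ c₃ c₄ m =
    trans (sum-box B _) (∑-cong B λ x →
    trans (sum-box B _) (∑-cong B λ y →
    trans (sum-box B _) (∑-cong B λ z →
    trans (sum-box B _) (∑-cong B λ w →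
    cong χ₀ (unnest m (+ c₁) (+ c₂) (+ c₃) (+ c₄) (f x) (f y) (f z) (f w))))))
    where
    unnest : ∀ m a b c d p q r s → (((m - a * p) - b * q) - c * r) - d * s ≡ m - (a * p + b * q + c * r + d * s)
    unnest = solve-∀

  countBox-supported : ∀ (f : ℤ → ℤ) (F : ℤ → ℕ) d m c₁ c₂ c₃ c₄ →
                       .{{NonZero c₁}} → .{{NonZero c₂}} → .{{NonZero c₃}} → .{{NonZero c₄}} →
                       (∀ x → f x ≡ + F x) → (∀ x → ∣ x ∣ ℕ.≤ d ℕ.+ F x) →
                       Supported⁴ (d ℕ.+ m) (λ x y z w → χ₀ (+ m - weighted c₁ c₂ c₃ c₄ f x y z w))
  countBox-supported f F d m c₁ c₂ c₃ c₄ f≡F ∣x∣≤ x y z w out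
    with χ₀ (+ m - weighted c₁ c₂ c₃ c₄ f x y z w) ℕ.≟ 0
  ... | yes χ₀≡0 = χ₀≡0
  ... | no χ₀≢0  = contradiction out (λ
    { (inj₁ o)                → ℕₚ.<⇒≱ o (coordinate c₁ x
                                    (ℕₚ.≤-trans (ℕₚ.m≤m+n X Y) (ℕₚ.≤-trans (ℕₚ.m≤m+n _ Z) (ℕₚ.m≤m+n _ W))))
    ; (inj₂ (inj₁ o))         → ℕₚ.<⇒≱ o (coordinate c₂ y
                                    (ℕₚ.≤-trans (ℕₚ.m≤n+m Y X) (ℕₚ.≤-trans (ℕₚ.m≤m+n _ Z) (ℕₚ.m≤m+n _ W))))
    ; (inj₂ (inj₂ (inj₁ o)))  → ℕₚ.<⇒≱ o (coordinate c₃ z (ℕₚ.≤-trans (ℕₚ.m≤n+m Z (X ℕ.+ Y)) (ℕₚ.m≤m+n _ W)))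
    ; (inj₂ (inj₂ (inj₂ o)))  → ℕₚ.<⇒≱ o (coordinate c₄ w (ℕₚ.m≤n+m W (X ℕ.+ Y ℕ.+ Z))) })
    where
    X Y Z W : ℕ
    X = c₁ ℕ.* F x
    Y = c₂ ℕ.* F y
    Z = c₃ ℕ.* F z
    W = c₄ ℕ.* F w
    term : ∀ c v → + (c ℕ.* F v) ≡ + c * f v
    term c v = trans (ℤₚ.pos-* c (F v)) (cong (+ c *_) (sym (f≡F v)))
    total : X ℕ.+ Y ℕ.+ Z ℕ.+ W ≡ m
    total = ℤₚ.+-injective (begin
      + (X ℕ.+ Y ℕ.+ Z ℕ.+ W)
        ≡⟨ ℤₚ.pos-+ (X ℕ.+ Y ℕ.+ Z) W ⟩
      + (X ℕ.+ Y ℕ.+ Z) + + W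
        ≡⟨ cong (_+ + W) (trans (ℤₚ.pos-+ (X ℕ.+ Y) Z) (cong (_+ + Z) (ℤₚ.pos-+ X Y))) ⟩
      + X + + Y + + Z + + W
        ≡⟨ cong₂ _+_ (cong₂ _+_ (cong₂ _+_ (term c₁ x) (term c₂ y)) (term c₃ z)) (term c₄ w) ⟩
      weighted c₁ c₂ c₃ c₄ f x y z w
        ≡⟨ ℤₚ.i-j≡0⇒i≡j (+ m) _ (χ₀≢0⇒≡0 _ χ₀≢0) ⟨
      + m ∎)
      where open ≡-Reasoning
    coordinate : ∀ c v → .{{NonZero c}} → c ℕ.* F v ℕ.≤ X ℕ.+ Y ℕ.+ Z ℕ.+ W → ∣ v ∣ ℕ.≤ d ℕ.+ m
    coordinate c v cFv≤ = ℕₚ.≤-trans (∣x∣≤ v)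
      (ℕₚ.+-monoʳ-≤ d (ℕₚ.≤-trans (ℕₚ.m≤n*m (F v) c) (ℕₚ.≤-trans cFv≤ (ℕₚ.≤-reflexive total))))

module Triangular where

  open import Data.Integer using (_+_; _-_; -_; _*_)
  open import Data.Nat.DivMod using (_/_; m*n/n≡m)
  open WindowSums using (bit1)

  triangular : ℕ → ℕ
  triangular zero    = 0
  triangular (suc m) = triangular m ℕ.+ m

  triangular-*2 : ∀ m → triangular m ℕ.* 2 ≡ m ℕ.* (m ℕ.∸ 1)
  triangular-*2 zero          = refl
  triangular-*2 (suc zero)    = refl
  triangular-*2 (suc (suc m)) = begin
    (triangular (suc m) ℕ.+ suc m) ℕ.* 2       ≡⟨ ℕₚ.*-distribʳ-+ 2 (triangular (suc m)) (suc m) ⟩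
    triangular (suc m) ℕ.* 2 ℕ.+ suc m ℕ.* 2   ≡⟨ cong (ℕ._+ suc m ℕ.* 2) (triangular-*2 (suc m)) ⟩
    suc m ℕ.* m ℕ.+ suc m ℕ.* 2                ≡⟨ step m ⟩
    suc (suc m) ℕ.* suc m                      ∎
    where
    open ≡-Reasoning
    step : ∀ m → suc m ℕ.* m ℕ.+ suc m ℕ.* 2 ≡ suc (suc m) ℕ.* suc m
    step = ℕ-Solver.solve-∀

  triN : ℤ → ℕ
  triN (+ m)    = triangular m
  triN -[1+ m ] = triangular (suc (suc m))

  tri≡triN : ∀ x → tri x ≡ + triN x
  tri≡triN (+ m)    = cong +_ (trans (cong (_/ 2) (sym (triangular-*2 m))) (m*n/n≡m (triangular m) 2))
  tri≡triN -[1+ m ] = cong +_ (trans (cong (_/ 2) (trans (ℕₚ.*-comm (suc m) (suc (suc m))) (sym (triangular-*2 (suc (suc m))))))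
                                     (m*n/n≡m (triangular (suc (suc m))) 2))

  2*tri : ∀ x → + 2 * tri x ≡ x * x - x
  2*tri x rewrite tri≡triN x = trans (sym (ℤₚ.pos-* 2 (triN x))) (doubled x)
    where
    doubled : ∀ x → + (2 ℕ.* triN x) ≡ x * x - x
    doubled (+ zero)    = refl
    doubled (+ suc m)   = begin
      + (2 ℕ.* triangular (suc m))      ≡⟨ cong +_ (trans (ℕₚ.*-comm 2 (triangular (suc m))) (triangular-*2 (suc m))) ⟩
      + (suc m ℕ.* m)                   ≡⟨ ℤₚ.pos-* (suc m) m ⟩
      + suc m * + m                     ≡⟨ identity (+ m) ⟩
      + suc m * + suc m - + suc m       ∎
      where
      open ≡-Reasoning
      identity : ∀ m → (+ 1 + m) * m ≡ (+ 1 + m) * (+ 1 + m) - (+ 1 + m)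
      identity = solve-∀
    doubled -[1+ m ] = begin
      + (2 ℕ.* triangular (suc (suc m)))   ≡⟨ cong +_ (trans (ℕₚ.*-comm 2 (triangular (suc (suc m)))) (triangular-*2 (suc (suc m)))) ⟩
      + (suc (suc m) ℕ.* suc m)            ≡⟨ ℤₚ.pos-* (suc (suc m)) (suc m) ⟩
      + suc (suc m) * + suc m              ≡⟨ identity (+ m) ⟩
      -[1+ m ] * -[1+ m ] - -[1+ m ]       ∎
      where
      open ≡-Reasoning
      identity : ∀ m → (+ 2 + m) * (+ 1 + m) ≡ - (+ 1 + m) * - (+ 1 + m) - - (+ 1 + m)
      identity = solve-∀

  odd-square : ∀ y → bit1 y * bit1 y ≡ + 8 * tri (y + + 1) + + 1
  odd-square y = begin
    bit1 y * bit1 y                              ≡⟨ expand y ⟩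
    + 4 * ((y + + 1) * (y + + 1) - (y + + 1)) + + 1 ≡⟨ cong (λ t → + 4 * t + + 1) (2*tri (y + + 1)) ⟨
    + 4 * (+ 2 * tri (y + + 1)) + + 1            ≡⟨ cong (_+ + 1) (ℤₚ.*-assoc (+ 4) (+ 2) (tri (y + + 1))) ⟨
    + 8 * tri (y + + 1) + + 1                    ∎
    where
    open ≡-Reasoning
    expand : ∀ y → (y + y + + 1) * (y + y + + 1) ≡ + 4 * ((y + + 1) * (y + + 1) - (y + + 1)) + + 1
    expand = solve-∀

  ∣x∣≤1+triN : ∀ x → ∣ x ∣ ℕ.≤ 1 ℕ.+ triN x
  ∣x∣≤1+triN (+ zero)  = z≤n
  ∣x∣≤1+triN (+ suc m) = s≤s (ℕₚ.m≤n+m m (triangular m))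
  ∣x∣≤1+triN -[1+ m ]  = s≤s (ℕₚ.≤-trans (ℕₚ.n≤1+n m) (ℕₚ.m≤n+m (suc m) (triangular (suc m))))

  square≡∣x∣² : ∀ x → square x ≡ + (∣ x ∣ ℕ.* ∣ x ∣)
  square≡∣x∣² (+ n)    = sym (ℤₚ.pos-* n n)
  square≡∣x∣² -[1+ n ] = refl

  ∣x∣≤∣x∣² : ∀ x → ∣ x ∣ ℕ.≤ ∣ x ∣ ℕ.* ∣ x ∣
  ∣x∣≤∣x∣² x with ∣ x ∣
  ... | zero  = z≤n
  ... | suc n = ℕₚ.m≤m*n (suc n) (suc n)

  x*x≡x+2*tri : ∀ x → x * x ≡ x + + 2 * tri x
  x*x≡x+2*tri x = trans (rearrange x) (cong (_+_ x) (sym (2*tri x)))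
    where
    rearrange : ∀ x → x * x ≡ x + (x * x - x)
    rearrange = solve-∀

module Forms (α β : ℕ) where

  open import Data.Integer using (_+_; _-_; -_; _*_)
  open import Data.List using (List; []; _∷_)
  open WindowSums
  open MultipleSums
  open Indicators
  open Triangular

  a b : ℕ
  a = suc (2 ℕ.* α)
  b = suc (2 ℕ.* β)

  A B : ℤ
  A = + 1 + + 2 * + α
  B = + 1 + + 2 * + β

  +a≡A : + a ≡ A
  +a≡A = cong (_+_ (+ 1)) (ℤₚ.pos-* 2 α)

  +b≡B : + b ≡ B
  +b≡B = cong (_+_ (+ 1)) (ℤₚ.pos-* 2 β)

  +[c*a]≡c*A : ∀ c → + (c ℕ.* a) ≡ + c * A
  +[c*a]≡c*A c = trans (ℤₚ.pos-* c a) (cong (+ c *_) +a≡A)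

  +[c*b]≡c*B : ∀ c → + (c ℕ.* b) ≡ + c * B
  +[c*b]≡c*B c = trans (ℤₚ.pos-* c b) (cong (+ c *_) +b≡B)

  sol : ℤ → ℤ → ℤ → ℤ → ℤ → ℕ
  sol m u v s w = χ₀ (m - (A * (u * u + v * v + s * s) + + 2 * B * (w * w)))

  sol-cong-squares : ∀ m u v s u′ v′ s′ w → u * u + v * v + s * s ≡ u′ * u′ + v′ * v′ + s′ * s′ →
                     sol m u v s w ≡ sol m u′ v′ s′ w
  sol-cong-squares m u v s u′ v′ s′ w eq = cong (λ Σsq → χ₀ (m - (A * Σsq + + 2 * B * (w * w)))) eq

  sol-cycle : ∀ m u v s w → sol m u v s w ≡ sol m v s u w
  sol-cycle m u v s w = sol-cong-squares m u v s v s u w (cycle u v s)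
    where
    cycle : ∀ u v s → u * u + v * v + s * s ≡ v * v + s * s + u * u
    cycle = solve-∀

  sol-swap₂₃ : ∀ m u v s w → sol m u v s w ≡ sol m u s v w
  sol-swap₂₃ m u v s w = sol-cong-squares m u v s u s v w (swap u v s)
    where
    swap : ∀ u v s → u * u + v * v + s * s ≡ u * u + s * s + v * v
    swap = solve-∀

  sol-neg₂ : ∀ m u v s w → sol m u (- v) s w ≡ sol m u v s w
  sol-neg₂ m u v s w = sol-cong-squares m u (- v) s u v s w (negate u v s)
    where
    negate : ∀ u v s → u * u + - v * - v + s * s ≡ u * u + v * v + s * s
    negate = solve-∀

  L₁ L₂ L₃ : List ℕ
  L₁ = a ∷ a ∷ 2 ℕ.* a ∷ b ∷ []
  L₂ = a ∷ a ∷ a ∷ 2 ℕ.* b ∷ []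
  L₃ = a ∷ 2 ℕ.* a ∷ 4 ℕ.* a ∷ b ∷ []

  weighted-L₂ : ∀ m u v s w → χ₀ (m - weighted a a a (2 ℕ.* b) square u v s w) ≡ sol m u v s w
  weighted-L₂ m u v s w = cong (λ q → χ₀ (m - q))
    (trans (weighted-cong square u v s w +a≡A +a≡A +a≡A (+[c*b]≡c*B 2)) (collect A B u v s w))
    where
    collect : ∀ A B u v s w → A * (u * u) + A * (v * v) + A * (s * s) + + 2 * B * (w * w)
                              ≡ A * (u * u + v * v + s * s) + + 2 * B * (w * w)
    collect = solve-∀

  N-as-∑ : ∀ M → N L₂ M ≡ ∑⁴ M (sol (+ M))
  N-as-∑ M = trans (countBox-∑⁴ square M a a a (2 ℕ.* b) (+ M)) (∑⁴-cong M (weighted-L₂ (+ M)))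

  sol-supported : ∀ M → Supported⁴ M (sol (+ M))
  sol-supported M x y z w out =
    trans (sym (weighted-L₂ (+ M) x y z w))
          (countBox-supported square (λ x → ∣ x ∣ ℕ.* ∣ x ∣) 0 M a a a (2 ℕ.* b) square≡∣x∣² ∣x∣≤∣x∣² x y z w out)

  sol-residue : ∀ m u v s w {Σsq W} k r X → u * u + v * v + s * s ≡ Σsq → w * w ≡ W →
                m - (A * Σsq + + 2 * B * W) ≡ + k * X + + r → 0 ℕ.< r → r ℕ.< k → sol m u v s w ≡ 0
  sol-residue m u v s w k r X refl refl eq 0<r r<k = trans (cong χ₀ eq) (χ₀-residue k r X 0<r r<k)

  sol-odd : ∀ q u v s w K → u + v + s ≡ + 2 * K + + 1 → sol (+ 2 * q) u v s w ≡ 0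
  sol-odd q u v s w K odd-sum =
    sol-residue (+ 2 * q) u v s w 2 1 (q - A * K′ - + α - + 1 - B * (w * w)) squares refl
                (identity (+ α) (+ β) q K′ (w * w)) (s≤s z≤n) (s≤s (s≤s z≤n))
    where
    K′ : ℤ
    K′ = K + tri u + tri v + tri s
    collect : ∀ u v s T₁ T₂ T₃ K → u + v + s ≡ + 2 * K + + 1 →
              u + + 2 * T₁ + (v + + 2 * T₂) + (s + + 2 * T₃) ≡ + 2 * (K + T₁ + T₂ + T₃) + + 1
    collect u v s T₁ T₂ T₃ K eq =
      trans (regroup u v s T₁ T₂ T₃) (trans (cong (_+ + 2 * (T₁ + T₂ + T₃)) eq) (regroup′ K T₁ T₂ T₃))
      where
      regroup : ∀ u v s T₁ T₂ T₃ → u + + 2 * T₁ + (v + + 2 * T₂) + (s + + 2 * T₃) ≡ u + v + s + + 2 * (T₁ + T₂ + T₃)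
      regroup = solve-∀
      regroup′ : ∀ K T₁ T₂ T₃ → + 2 * K + + 1 + + 2 * (T₁ + T₂ + T₃) ≡ + 2 * (K + T₁ + T₂ + T₃) + + 1
      regroup′ = solve-∀
    squares : u * u + v * v + s * s ≡ + 2 * K′ + + 1
    squares = trans (cong₂ _+_ (cong₂ _+_ (x*x≡x+2*tri u) (x*x≡x+2*tri v)) (x*x≡x+2*tri s))
                    (collect u v s (tri u) (tri v) (tri s) K odd-sum)
    identity : ∀ α β q K W → let A = + 1 + + 2 * α; B = + 1 + + 2 * β in
               + 2 * q - (A * (+ 2 * K + + 1) + + 2 * B * W) ≡ + 2 * (q - A * K - α - + 1 - B * W) + + 1
    identity = solve-∀

  sol-even-odd : ∀ q u v s w K L → u * u + v * v + s * s ≡ + 4 * K → w * w ≡ + 2 * L + + 1 → sol (+ 4 * q) u v s w ≡ 0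
  sol-even-odd q u v s w K L Σsq w² =
    sol-residue (+ 4 * q) u v s w 4 2 (q - A * K - B * L - + β - + 1) Σsq w² (identity (+ α) (+ β) q K L)
                (s≤s z≤n) (s≤s (s≤s (s≤s z≤n)))
    where
    identity : ∀ α β q K L → let A = + 1 + + 2 * α; B = + 1 + + 2 * β in
               + 4 * q - (A * (+ 4 * K) + + 2 * B * (+ 2 * L + + 1)) ≡ + 4 * (q - A * K - B * L - β - + 1) + + 2
    identity = solve-∀

  sol-scale : ∀ q u v s w → sol (+ 4 * q) (bit0 u) (bit0 v) (bit0 s) (bit0 w) ≡ sol q u v s w
  sol-scale q u v s w = trans (cong χ₀ (identity (+ α) (+ β) q u v s w)) (χ₀-*-cancel (+ 4) _ (λ ()))
    where
    identity : ∀ α β q u v s w → let A = + 1 + + 2 * α; B = + 1 + + 2 * β in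
               + 4 * q - (A * ((u + u) * (u + u) + (v + v) * (v + v) + (s + s) * (s + s)) + + 2 * B * ((w + w) * (w + w)))
               ≡ + 4 * (q - (A * (u * u + v * v + s * s) + + 2 * B * (w * w)))
    identity = solve-∀

  Nᵉᵉᵉ Nᵒᵒᵉ : ℕ → ℕ
  Nᵉᵉᵉ M = ∑⁴ M (λ u v s w → sol (+ M) (bit0 u) (bit0 v) (bit0 s) w)
  Nᵒᵒᵉ M = ∑⁴ M (λ u v s w → sol (+ M) (bit1 u) (bit1 v) (bit0 s) w)

  ∑³-odd-pattern : ∀ m (p₁ p₂ p₃ : ℤ → ℤ) (K : ℤ → ℤ → ℤ → ℤ) →
                   (∀ x y z → p₁ x + p₂ y + p₃ z ≡ + 2 * K x y z + + 1) →
                   ∑³ (2 ℕ.* m) (λ x y z → ∑ (2 ℕ.* m) (sol (+ (2 ℕ.* m)) (p₁ x) (p₂ y) (p₃ z))) ≡ 0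
  ∑³-odd-pattern m p₁ p₂ p₃ K odd-sum = ∑³-zero (2 ℕ.* m) λ x y z → ∑-zero (2 ℕ.* m) λ w →
    trans (cong (λ m′ → sol m′ (p₁ x) (p₂ y) (p₃ z) w) (ℤₚ.pos-* 2 m))
          (sol-odd (+ m) (p₁ x) (p₂ y) (p₃ z) w (K x y z) (odd-sum x y z))

  -- The three patterns with two odd entries among u, v, s are permutations of each other.
  N-parity-split : ∀ M m → M ≡ 2 ℕ.* m → N L₂ M ≡ Nᵉᵉᵉ M ℕ.+ 3 ℕ.* Nᵒᵒᵉ M
  N-parity-split M m refl = begin
    N L₂ M
      ≡⟨ N-as-∑ M ⟩
    ∑³ M G
      ≡⟨ ∑³-parity M G (λ x y z out → ∑-zero M λ w → sol-supported M x y z w (inj-first out)) ⟩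
    (Nᵉᵉᵉ M ℕ.+ ∑³ M (λ x y z → G (bit0 x) (bit0 y) (bit1 z))
      ℕ.+ ∑³ M (λ x y z → G (bit0 x) (bit1 y) (bit0 z)) ℕ.+ ∑³ M (λ x y z → G (bit0 x) (bit1 y) (bit1 z)))
    ℕ.+ (∑³ M (λ x y z → G (bit1 x) (bit0 y) (bit0 z)) ℕ.+ ∑³ M (λ x y z → G (bit1 x) (bit0 y) (bit1 z))
      ℕ.+ Nᵒᵒᵉ M ℕ.+ ∑³ M (λ x y z → G (bit1 x) (bit1 y) (bit1 z)))
      ≡⟨ cong₂ ℕ._+_ (cong₂ ℕ._+_ (cong₂ ℕ._+_ (cong (Nᵉᵉᵉ M ℕ.+_) (∑³-odd-pattern m bit0 bit0 bit1 K eeo))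
                                              (∑³-odd-pattern m bit0 bit1 bit0 K eoe))
                                  eoo)
                     (cong₂ ℕ._+_ (cong (ℕ._+ Nᵒᵒᵉ M) (cong₂ ℕ._+_ (∑³-odd-pattern m bit1 bit0 bit0 K oee) oeo))
                                  (∑³-odd-pattern m bit1 bit1 bit1 (λ x y z → K x y z + + 1) ooo)) ⟩
    (Nᵉᵉᵉ M ℕ.+ 0 ℕ.+ 0 ℕ.+ Nᵒᵒᵉ M) ℕ.+ (0 ℕ.+ Nᵒᵒᵉ M ℕ.+ Nᵒᵒᵉ M ℕ.+ 0)
      ≡⟨ collect (Nᵉᵉᵉ M) (Nᵒᵒᵉ M) ⟩
    Nᵉᵉᵉ M ℕ.+ 3 ℕ.* Nᵒᵒᵉ M ∎
    where
    open ≡-Reasoning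
    G : ℤ → ℤ → ℤ → ℕ
    G u v s = ∑ M (sol (+ M) u v s)
    inj-first : ∀ {P Q R S : Set} → P ⊎ Q ⊎ R → P ⊎ Q ⊎ R ⊎ S
    inj-first (inj₁ p)        = inj₁ p
    inj-first (inj₂ (inj₁ q)) = inj₂ (inj₁ q)
    inj-first (inj₂ (inj₂ r)) = inj₂ (inj₂ (inj₁ r))
    K : ℤ → ℤ → ℤ → ℤ
    K x y z = x + y + z
    eeo : ∀ x y z → x + x + (y + y) + (z + z + + 1) ≡ + 2 * (x + y + z) + + 1
    eeo = solve-∀
    eoe : ∀ x y z → x + x + (y + y + + 1) + (z + z) ≡ + 2 * (x + y + z) + + 1
    eoe = solve-∀
    oee : ∀ x y z → x + x + + 1 + (y + y) + (z + z) ≡ + 2 * (x + y + z) + + 1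
    oee = solve-∀
    ooo : ∀ x y z → x + x + + 1 + (y + y + + 1) + (z + z + + 1) ≡ + 2 * (x + y + z + + 1) + + 1
    ooo = solve-∀
    eoo : ∑³ M (λ x y z → G (bit0 x) (bit1 y) (bit1 z)) ≡ Nᵒᵒᵉ M
    eoo = trans (∑³-cong M λ x y z → ∑-cong M λ w → sol-cycle (+ M) (bit0 x) (bit1 y) (bit1 z) w)
                (∑³-cycle M (λ x y z → G (bit1 x) (bit1 y) (bit0 z)))
    oeo : ∑³ M (λ x y z → G (bit1 x) (bit0 y) (bit1 z)) ≡ Nᵒᵒᵉ M
    oeo = trans (∑³-cong M λ x y z → ∑-cong M λ w → sol-swap₂₃ (+ M) (bit1 x) (bit0 y) (bit1 z) w)
                (∑³-swap₂₃ M (λ x y z → G (bit1 x) (bit1 y) (bit0 z)))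
    collect : ∀ E O → (E ℕ.+ 0 ℕ.+ 0 ℕ.+ O) ℕ.+ (0 ℕ.+ O ℕ.+ O ℕ.+ 0) ≡ E ℕ.+ 3 ℕ.* O
    collect = ℕ-Solver.solve-∀

  Nᵉᵉᵉ-4* : ∀ Q → Nᵉᵉᵉ (4 ℕ.* Q) ≡ N L₂ Q
  Nᵉᵉᵉ-4* Q = begin
    Nᵉᵉᵉ M
      ≡⟨ ∑³-cong M (λ u v s → trans (∑-parity M M _ (λ w out → sol-supported M (bit0 u) (bit0 v) (bit0 s) w
                                                                              (inj₂ (inj₂ (inj₂ out))))
                                                   ℕₚ.≤-refl)
                                   (trans (cong₂ ℕ._+_ (∑-cong M (scale u v s)) (∑-zero M (even-odd u v s)))
                                          (ℕₚ.+-identityʳ _))) ⟩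
    ∑⁴ M (sol (+ Q))
      ≡⟨ ∑⁴-enlarge Q M (sol (+ Q)) (sol-supported Q) (ℕₚ.m≤n*m Q 4) ⟩
    ∑⁴ Q (sol (+ Q))
      ≡⟨ N-as-∑ Q ⟨
    N L₂ Q ∎
    where
    open ≡-Reasoning
    M : ℕ
    M = 4 ℕ.* Q
    +M≡4*Q : + M ≡ + 4 * + Q
    +M≡4*Q = ℤₚ.pos-* 4 Q
    scale : ∀ u v s w → sol (+ M) (bit0 u) (bit0 v) (bit0 s) (bit0 w) ≡ sol (+ Q) u v s w
    scale u v s w = trans (cong (λ m → sol m (bit0 u) (bit0 v) (bit0 s) (bit0 w)) +M≡4*Q) (sol-scale (+ Q) u v s w)
    even-odd : ∀ u v s w → sol (+ M) (bit0 u) (bit0 v) (bit0 s) (bit1 w) ≡ 0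
    even-odd u v s w = trans (cong (λ m → sol m (bit0 u) (bit0 v) (bit0 s) (bit1 w)) +M≡4*Q)
      (sol-even-odd (+ Q) (bit0 u) (bit0 v) (bit0 s) (bit1 w) (u * u + v * v + s * s) (+ 2 * (w * w + w)) (squares u v s) (odd-square′ w))
      where
      squares : ∀ u v s → (u + u) * (u + u) + (v + v) * (v + v) + (s + s) * (s + s) ≡ + 4 * (u * u + v * v + s * s)
      squares = solve-∀
      odd-square′ : ∀ w → (w + w + + 1) * (w + w + + 1) ≡ + 2 * (+ 2 * (w * w + w)) + + 1
      odd-square′ = solve-∀

  -- Doubling: 2 (a x² + a y²) = a (x + y)² + a (x - y)².
  N-L₁ : ∀ Q → N L₁ (2 ℕ.* Q) ≡ Nᵉᵉᵉ (4 ℕ.* Q) ℕ.+ Nᵒᵒᵉ (4 ℕ.* Q)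
  N-L₁ Q = begin
    N L₁ (2 ℕ.* Q)
      ≡⟨ countBox-∑⁴ square (2 ℕ.* Q) a a (2 ℕ.* a) b (+ (2 ℕ.* Q)) ⟩
    ∑⁴ (2 ℕ.* Q) g
      ≡⟨ ∑⁴-enlarge (2 ℕ.* Q) M g
           (countBox-supported square (λ x → ∣ x ∣ ℕ.* ∣ x ∣) 0 (2 ℕ.* Q) a a (2 ℕ.* a) b square≡∣x∣² ∣x∣≤∣x∣²)
           (ℕₚ.*-monoˡ-≤ Q {2} {4} (s≤s (s≤s z≤n))) ⟨
    ∑⁴ M g
      ≡⟨ ∑⁴-cong M rotated ⟩
    ∑² M (λ x y → F (x + y) (x - y))
      ≡⟨ ∑²-rotate M F (λ u v → λ
           { (inj₁ out) → ∑-zero M λ z → ∑-zero M λ w → sol-supported M u v (bit0 z) w (inj₁ out)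
           ; (inj₂ out) → ∑-zero M λ z → ∑-zero M λ w → sol-supported M u v (bit0 z) w (inj₂ (inj₁ out)) }) ⟩
    Nᵉᵉᵉ M ℕ.+ Nᵒᵒᵉ M ∎
    where
    open ≡-Reasoning
    M : ℕ
    M = 4 ℕ.* Q
    g : ℤ → ℤ → ℤ → ℤ → ℕ
    g x y z w = χ₀ (+ (2 ℕ.* Q) - weighted a a (2 ℕ.* a) b square x y z w)
    F : ℤ → ℤ → ℕ
    F u v = ∑² M (λ z w → sol (+ M) u v (bit0 z) w)
    identity : ∀ A B Q x y z w →
               + 2 * (+ 2 * Q - (A * (x * x) + A * (y * y) + + 2 * A * (z * z) + B * (w * w)))
               ≡ + 4 * Q - (A * ((x + y) * (x + y) + (x - y) * (x - y) + (z + z) * (z + z)) + + 2 * B * (w * w))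
    identity = solve-∀
    rotated : ∀ x y z w → g x y z w ≡ sol (+ M) (x + y) (x - y) (bit0 z) w
    rotated x y z w = begin
      g x y z w
        ≡⟨ cong₂ (λ m q → χ₀ (m - q)) (ℤₚ.pos-* 2 Q) (weighted-cong square x y z w +a≡A +a≡A (+[c*a]≡c*A 2) +b≡B) ⟩
      χ₀ (+ 2 * + Q - (A * (x * x) + A * (y * y) + + 2 * A * (z * z) + B * (w * w)))
        ≡⟨ χ₀-*-cancel (+ 2) _ (λ ()) ⟨
      χ₀ (+ 2 * (+ 2 * + Q - (A * (x * x) + A * (y * y) + + 2 * A * (z * z) + B * (w * w))))
        ≡⟨ cong χ₀ (trans (identity A B (+ Q) x y z w) (cong (λ m → m - _) (sym (ℤₚ.pos-* 4 Q)))) ⟩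
      sol (+ M) (x + y) (x - y) (bit0 z) w ∎

  N-identity₁ : ∀ Q → 3 ℕ.* N L₁ (2 ℕ.* Q) ≡ N L₂ (4 ℕ.* Q) ℕ.+ 2 ℕ.* N L₂ Q
  N-identity₁ Q = begin
    3 ℕ.* N L₁ (2 ℕ.* Q)                     ≡⟨ cong (3 ℕ.*_) (N-L₁ Q) ⟩
    3 ℕ.* (E ℕ.+ O)                          ≡⟨ regroup E O ⟩
    E ℕ.+ 3 ℕ.* O ℕ.+ 2 ℕ.* E                ≡⟨ cong₂ (λ x y → x ℕ.+ 2 ℕ.* y)
                                                     (sym (N-parity-split (4 ℕ.* Q) (2 ℕ.* Q) (4*≡2*2* Q))) (Nᵉᵉᵉ-4* Q) ⟩
    N L₂ (4 ℕ.* Q) ℕ.+ 2 ℕ.* N L₂ Q          ∎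
    where
    open ≡-Reasoning
    E O : ℕ
    E = Nᵉᵉᵉ (4 ℕ.* Q)
    O = Nᵒᵒᵉ (4 ℕ.* Q)
    regroup : ∀ E O → 3 ℕ.* (E ℕ.+ O) ≡ E ℕ.+ 3 ℕ.* O ℕ.+ 2 ℕ.* E
    regroup = ℕ-Solver.solve-∀
    4*≡2*2* : ∀ q → 4 ℕ.* q ≡ 2 ℕ.* (2 ℕ.* q)
    4*≡2*2* = ℕ-Solver.solve-∀

  module _ (n : ℕ) where

    M : ℕ
    M = 16 ℕ.* n ℕ.+ 14 ℕ.* a ℕ.+ 2 ℕ.* b

    +M≡ : + M ≡ + 16 * + n + + 14 * A + + 2 * B
    +M≡ = trans (ℤₚ.pos-+ (16 ℕ.* n ℕ.+ 14 ℕ.* a) (2 ℕ.* b))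
                (cong₂ _+_ (trans (ℤₚ.pos-+ (16 ℕ.* n) (14 ℕ.* a)) (cong₂ _+_ (ℤₚ.pos-* 16 n) (+[c*a]≡c*A 14)))
                           (+[c*b]≡c*B 2))

    residue : ∀ u v s w {Σsq W} k r X → u * u + v * v + s * s ≡ Σsq → w * w ≡ W →
              + 16 * + n + + 14 * A + + 2 * B - (A * Σsq + + 2 * B * W) ≡ + k * X + + r → 0 ℕ.< r → r ℕ.< k →
              sol (+ M) u v s w ≡ 0
    residue u v s w k r X Σsq W eq 0<r r<k =
      trans (cong (λ m → sol m u v s w) +M≡) (sol-residue (+ 16 * + n + + 14 * A + + 2 * B) u v s w k r X Σsq W eq 0<r r<k)

    sol-w-even : ∀ i j s w → sol (+ M) (bit1 i) (bit1 j) (bit0 s) (bit0 w) ≡ 0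
    sol-w-even i j s w = residue (bit1 i) (bit1 j) (bit0 s) (bit0 w) 4 2 (+ 4 * + n + + 3 * A - A * K - + 2 * B * (w * w) + + β)
                           (squares i j s) (even-square w) (identity (+ α) (+ β) (+ n) K (w * w))
                           (s≤s z≤n) (s≤s (s≤s (s≤s z≤n)))
      where
      K : ℤ
      K = i * i + i + j * j + j + s * s
      squares : ∀ i j s → (i + i + + 1) * (i + i + + 1) + (j + j + + 1) * (j + j + + 1) + (s + s) * (s + s)
                          ≡ + 4 * (i * i + i + j * j + j + s * s) + + 2
      squares = solve-∀
      even-square : ∀ w → (w + w) * (w + w) ≡ + 4 * (w * w)
      even-square = solve-∀
      identity : ∀ α β n K L → let A = + 1 + + 2 * α; B = + 1 + + 2 * β in
                 + 16 * n + + 14 * A + + 2 * B - (A * (+ 4 * K + + 2) + + 2 * B * (+ 4 * L))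
                 ≡ + 4 * (+ 4 * n + + 3 * A - A * K - + 2 * B * L + β) + + 2
      identity = solve-∀

    sol-s-multiple-of-4 : ∀ i j s w → sol (+ M) (bit1 i) (bit1 j) (bit0 (bit0 s)) (bit1 w) ≡ 0
    sol-s-multiple-of-4 i j s w =
      residue (bit1 i) (bit1 j) (bit0 (bit0 s)) (bit1 w) 8 4 (+ 2 * + n + + 1 + + 3 * + α - A * K - + 2 * B * tri (w + + 1))
        squares (odd-square w) (identity (+ α) (+ β) (+ n) K (tri (w + + 1)))
        (s≤s z≤n) (s≤s (s≤s (s≤s (s≤s (s≤s z≤n)))))
      where
      K : ℤ
      K = tri (i + + 1) + tri (j + + 1) + + 2 * (s * s)
      collect : ∀ Tᵢ Tⱼ s → + 8 * Tᵢ + + 1 + (+ 8 * Tⱼ + + 1) + (s + s + (s + s)) * (s + s + (s + s))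
                            ≡ + 8 * (Tᵢ + Tⱼ + + 2 * (s * s)) + + 2
      collect = solve-∀
      squares : bit1 i * bit1 i + bit1 j * bit1 j + bit0 (bit0 s) * bit0 (bit0 s) ≡ + 8 * K + + 2
      squares = trans (cong₂ (λ I J → I + J + bit0 (bit0 s) * bit0 (bit0 s)) (odd-square i) (odd-square j))
                      (collect (tri (i + + 1)) (tri (j + + 1)) s)
      identity : ∀ α β n K L → let A = + 1 + + 2 * α; B = + 1 + + 2 * β in
                 + 16 * n + + 14 * A + + 2 * B - (A * (+ 8 * K + + 2) + + 2 * B * (+ 8 * L + + 1))
                 ≡ + 8 * (+ 2 * n + + 1 + + 3 * α - A * K - + 2 * B * L) + + 4
      identity = solve-∀

    H : ℤ → ℤ → ℕ
    H u v = ∑² M (λ s w → sol (+ M) u v (bit0 (bit1 s)) (bit1 w))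

    H-supported : Supported² M H
    H-supported u v (inj₁ out) = ∑-zero M λ s → ∑-zero M λ w → sol-supported M u v (bit0 (bit1 s)) (bit1 w) (inj₁ out)
    H-supported u v (inj₂ out) = ∑-zero M λ s → ∑-zero M λ w → sol-supported M u v (bit0 (bit1 s)) (bit1 w) (inj₂ (inj₁ out))

    H-neg₂ : ∀ u v → H u (- v) ≡ H u v
    H-neg₂ u v = ∑-cong M λ s → ∑-cong M λ w → sol-neg₂ (+ M) u v (bit0 (bit1 s)) (bit1 w)

    H-even : ∀ m k → H (bit0 m) (bit0 k) ≡ 0
    H-even m k = ∑-zero M λ s → ∑-zero M λ w →
      let K = m * m + k * k + bit1 s * bit1 s in
      residue (bit0 m) (bit0 k) (bit0 (bit1 s)) (bit1 w) 4 2 (+ 4 * + n + + 3 + + 7 * + α - A * K - B * (+ 2 * (w * w + w)))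
        (squares m k s) (odd-square-mod-2 w) (identity (+ α) (+ β) (+ n) K (+ 2 * (w * w + w)))
        (s≤s z≤n) (s≤s (s≤s (s≤s z≤n)))
      where
      squares : ∀ m k s → (m + m) * (m + m) + (k + k) * (k + k) + (s + s + + 1 + (s + s + + 1)) * (s + s + + 1 + (s + s + + 1))
                          ≡ + 4 * (m * m + k * k + (s + s + + 1) * (s + s + + 1))
      squares = solve-∀
      odd-square-mod-2 : ∀ w → (w + w + + 1) * (w + w + + 1) ≡ + 2 * (+ 2 * (w * w + w)) + + 1
      odd-square-mod-2 = solve-∀
      identity : ∀ α β n K L → let A = + 1 + + 2 * α; B = + 1 + + 2 * β in
                 + 16 * n + + 14 * A + + 2 * B - (A * (+ 4 * K) + + 2 * B * (+ 2 * L + + 1))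
                 ≡ + 4 * (+ 4 * n + + 3 + + 7 * α - A * K - B * L) + + 2
      identity = solve-∀

    H-4p±odd : ∀ p q → H (bit0 (bit0 p) + bit1 q) (bit0 (bit0 p) - bit1 q) ≡ 0
    H-4p±odd p q = ∑-zero M λ s → ∑-zero M λ w →
      let K = + 2 * (p * p) + tri (q + + 1) + + 2 * tri (s + + 1) in
      residue (bit0 (bit0 p) + bit1 q) (bit0 (bit0 p) - bit1 q) (bit0 (bit1 s)) (bit1 w) 16 8 (+ n + + α - A * K - B * tri (w + + 1))
        (trans (expand p (bit1 q) (bit1 s))
               (trans (cong₂ (λ R S → + 32 * (p * p) + + 2 * R + + 4 * S) (odd-square q) (odd-square s))
                      (collect p (tri (q + + 1)) (tri (s + + 1)))))
        (odd-square w) (identity (+ α) (+ β) (+ n) K (tri (w + + 1)))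
        (s≤s z≤n) (ℕₚ.m≤m+n 9 7)
      where
      expand : ∀ p r S → (p + p + (p + p) + r) * (p + p + (p + p) + r) + (p + p + (p + p) - r) * (p + p + (p + p) - r) + (S + S) * (S + S)
                         ≡ + 32 * (p * p) + + 2 * (r * r) + + 4 * (S * S)
      expand = solve-∀
      collect : ∀ p Tq Ts → + 32 * (p * p) + + 2 * (+ 8 * Tq + + 1) + + 4 * (+ 8 * Ts + + 1)
                            ≡ + 16 * (+ 2 * (p * p) + Tq + + 2 * Ts) + + 6
      collect = solve-∀
      identity : ∀ α β n K L → let A = + 1 + + 2 * α; B = + 1 + + 2 * β in
                 + 16 * n + + 14 * A + + 2 * B - (A * (+ 16 * K + + 6) + + 2 * B * (+ 8 * L + + 1))
                 ≡ + 16 * (n + α - A * K - B * L) + + 8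
      identity = solve-∀

    Nᵒᵒᵉ-as-H : Nᵒᵒᵉ M ≡ ∑² M (λ i j → H (bit1 i) (bit1 j))
    Nᵒᵒᵉ-as-H = ∑-cong M λ i → ∑-cong M λ j → begin
      ∑² M (λ s w → sol (+ M) (bit1 i) (bit1 j) (bit0 s) w)
        ≡⟨ ∑-cong M (λ s → trans (∑-parity M M _ (λ w out → sol-supported M (bit1 i) (bit1 j) (bit0 s) w (inj₂ (inj₂ (inj₂ out))))
                                              ℕₚ.≤-refl)
                                (cong (ℕ._+ ∑ M (λ w → sol (+ M) (bit1 i) (bit1 j) (bit0 s) (bit1 w)))
                                      (∑-zero M (sol-w-even i j s)))) ⟩
      ∑² M (λ s w → sol (+ M) (bit1 i) (bit1 j) (bit0 s) (bit1 w))
        ≡⟨ ∑-parity M M _ (λ s out → ∑-zero M λ w → sol-supported M (bit1 i) (bit1 j) (bit0 s) (bit1 w)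
                                                      (inj₂ (inj₂ (inj₁ (bit0-grows s out)))))
                    ℕₚ.≤-refl ⟩
      ∑² M (λ s w → sol (+ M) (bit1 i) (bit1 j) (bit0 (bit0 s)) (bit1 w)) ℕ.+ H (bit1 i) (bit1 j)
        ≡⟨ cong (ℕ._+ H (bit1 i) (bit1 j)) (∑-zero M λ s → ∑-zero M (sol-s-multiple-of-4 i j s)) ⟩
      H (bit1 i) (bit1 j) ∎
      where open ≡-Reasoning

    ∑²-H-rotated : ∑² M (λ x y → H (x + y) (x - y)) ≡ ∑² M (λ i j → H (bit1 i) (bit1 j))
    ∑²-H-rotated = trans (∑²-rotate M H H-supported)
                         (cong (ℕ._+ ∑² M (λ i j → H (bit1 i) (bit1 j))) (∑-zero M λ i → ∑-zero M λ j → H-even i j))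

    -- x + y is odd exactly when one of x, y is odd; the two mixed cases agree after v ↦ -v.
    ∑²-H-rotated≡2*mixed : ∑² M (λ x y → H (x + y) (x - y)) ≡ 2 ℕ.* ∑² M (λ p q → H (bit0 p + bit1 q) (bit0 p - bit1 q))
    ∑²-H-rotated≡2*mixed = begin
      ∑² M (λ x y → H (x + y) (x - y))
        ≡⟨ ∑²-parity M (λ x y → H (x + y) (x - y)) rotated-supported ⟩
      ∑² M (λ p q → H (bit0 p + bit0 q) (bit0 p - bit0 q)) ℕ.+ E
        ℕ.+ ∑² M (λ p q → H (bit1 p + bit0 q) (bit1 p - bit0 q)) ℕ.+ ∑² M (λ p q → H (bit1 p + bit1 q) (bit1 p - bit1 q))
        ≡⟨ cong₂ ℕ._+_ (cong₂ ℕ._+_ (cong (ℕ._+ E) (∑-zero M λ p → ∑-zero M λ q → even-even p q))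
                                    (trans (∑-cong M λ p → ∑-cong M λ q → mirror p q)
                                           (∑-comm M M (λ p q → H (bit0 q + bit1 p) (bit0 q - bit1 p)))))
                       (∑-zero M λ p → ∑-zero M λ q → odd-odd p q) ⟩
      0 ℕ.+ E ℕ.+ E ℕ.+ 0
        ≡⟨ collect E ⟩
      2 ℕ.* E ∎
      where
      open ≡-Reasoning
      E : ℕ
      E = ∑² M (λ p q → H (bit0 p + bit1 q) (bit0 p - bit1 q))
      sum-difference : ∀ x y → (x + y) + (x - y) ≡ x + x
      sum-difference = solve-∀
      difference-difference : ∀ x y → (x + y) - (x - y) ≡ y + y
      difference-difference = solve-∀
      rotated-supported : Supported² M (λ x y → H (x + y) (x - y))
      rotated-supported x y (inj₁ out) = H-supported (x + y) (x - y) (apart-by-sum (x + y) (x - y) x (sum-difference x y) out)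
      rotated-supported x y (inj₂ out) = H-supported (x + y) (x - y) (apart-by-difference (x + y) (x - y) y (difference-difference x y) out)
      even-even : ∀ p q → H (bit0 p + bit0 q) (bit0 p - bit0 q) ≡ 0
      even-even p q = trans (cong₂ H (e+e p q) (e-e p q)) (H-even (p + q) (p - q))
        where
        e+e : ∀ p q → p + p + (q + q) ≡ (p + q) + (p + q)
        e+e = solve-∀
        e-e : ∀ p q → p + p - (q + q) ≡ (p - q) + (p - q)
        e-e = solve-∀
      odd-odd : ∀ p q → H (bit1 p + bit1 q) (bit1 p - bit1 q) ≡ 0
      odd-odd p q = trans (cong₂ H (o+o p q) (o-o p q)) (H-even (p + q + + 1) (p - q))
        where
        o+o : ∀ p q → p + p + + 1 + (q + q + + 1) ≡ (p + q + + 1) + (p + q + + 1)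
        o+o = solve-∀
        o-o : ∀ p q → p + p + + 1 - (q + q + + 1) ≡ (p - q) + (p - q)
        o-o = solve-∀
      mirror : ∀ p q → H (bit1 p + bit0 q) (bit1 p - bit0 q) ≡ H (bit0 q + bit1 p) (bit0 q - bit1 p)
      mirror p q = trans (cong₂ H (ℤₚ.+-comm (bit1 p) (bit0 q)) (negated (bit1 p) (bit0 q)))
                         (H-neg₂ (bit0 q + bit1 p) (bit0 q - bit1 p))
        where
        negated : ∀ x y → x - y ≡ - (y - x)
        negated = solve-∀
      collect : ∀ E → 0 ℕ.+ E ℕ.+ E ℕ.+ 0 ≡ 2 ℕ.* E
      collect = ℕ-Solver.solve-∀

    T : ℤ → ℤ → ℕ
    T y₁ y₃ = H (bit1 y₁ + bit0 (bit1 y₃)) (bit1 y₁ - bit0 (bit1 y₃))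

    ∑²-H-mixed : ∑² M (λ p q → H (bit0 p + bit1 q) (bit0 p - bit1 q)) ≡ ∑² M T
    ∑²-H-mixed = begin
      ∑² M (λ p q → H (bit0 p + bit1 q) (bit0 p - bit1 q))
        ≡⟨ ∑-parity M M _ (λ p out → ∑-zero M λ q → H-supported (bit0 p + bit1 q) (bit0 p - bit1 q)
                             (apart-by-sum (bit0 p + bit1 q) (bit0 p - bit1 q) (bit0 p) (sum-difference p q) (bit0-grows p out)))
                    ℕₚ.≤-refl ⟩
      ∑² M (λ p q → H (bit0 (bit0 p) + bit1 q) (bit0 (bit0 p) - bit1 q))
        ℕ.+ ∑² M (λ p q → H (bit0 (bit1 p) + bit1 q) (bit0 (bit1 p) - bit1 q))
        ≡⟨ cong₂ ℕ._+_ (∑-zero M λ p → ∑-zero M λ q → H-4p±odd p q)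
                       (trans (∑-cong M λ p → ∑-cong M λ q → mirror p q) (∑-comm M M (λ p q → T q p))) ⟩
      ∑² M T ∎
      where
      open ≡-Reasoning
      sum-difference : ∀ p q → p + p + (q + q + + 1) + (p + p - (q + q + + 1)) ≡ (p + p) + (p + p)
      sum-difference = solve-∀
      mirror : ∀ p q → H (bit0 (bit1 p) + bit1 q) (bit0 (bit1 p) - bit1 q) ≡ T q p
      mirror p q = trans (cong₂ H (ℤₚ.+-comm (bit0 (bit1 p)) (bit1 q)) (negated (bit0 (bit1 p)) (bit1 q)))
                         (H-neg₂ (bit1 q + bit0 (bit1 p)) (bit1 q - bit0 (bit1 p)))
        where
        negated : ∀ x y → x - y ≡ - (y - x)
        negated = solve-∀

    sol-16 : ∀ u v s w K L → u * u + v * v + s * s ≡ + 16 * K + + 14 → w * w ≡ + 8 * L + + 1 →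
             sol (+ M) u v s w ≡ χ₀ (+ n - (A * K + B * L))
    sol-16 u v s w K L Σsq W = begin
      sol (+ M) u v s w
        ≡⟨ cong₂ (λ m q → χ₀ (m - q)) +M≡ (cong₂ (λ Σ W → A * Σ + + 2 * B * W) Σsq W) ⟩
      χ₀ (+ 16 * + n + + 14 * A + + 2 * B - (A * (+ 16 * K + + 14) + + 2 * B * (+ 8 * L + + 1)))
        ≡⟨ cong χ₀ (identity (+ α) (+ β) (+ n) K L) ⟩
      χ₀ (+ 16 * (+ n - (A * K + B * L)))
        ≡⟨ χ₀-*-cancel (+ 16) _ (λ ()) ⟩
      χ₀ (+ n - (A * K + B * L)) ∎
      where
      open ≡-Reasoning
      identity : ∀ α β n K L → let A = + 1 + + 2 * α; B = + 1 + + 2 * β in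
                 + 16 * n + + 14 * A + + 2 * B - (A * (+ 16 * K + + 14) + + 2 * B * (+ 8 * L + + 1))
                 ≡ + 16 * (n - (A * K + B * L))
      identity = solve-∀

    T⁴ : ℤ → ℤ → ℤ → ℤ → ℕ
    T⁴ y₁ y₂ y₃ y₄ = sol (+ M) (bit1 y₁ + bit0 (bit1 y₃)) (bit1 y₁ - bit0 (bit1 y₃)) (bit0 (bit1 y₂)) (bit1 y₄)

    T⁴-supported : Supported⁴ M T⁴
    T⁴-supported y₁ y₂ y₃ y₄ out = sol-supported M u v (bit0 (bit1 y₂)) (bit1 y₄) (coordinates out)
      where
      u v : ℤ
      u = bit1 y₁ + bit0 (bit1 y₃)
      v = bit1 y₁ - bit0 (bit1 y₃)
      sum-difference : ∀ x y → x + y + (x - y) ≡ x + x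
      sum-difference = solve-∀
      difference-difference : ∀ x y → x + y - (x - y) ≡ y + y
      difference-difference = solve-∀
      pair : ∀ {P Q R S : Set} → P ⊎ Q → P ⊎ Q ⊎ R ⊎ S
      pair (inj₁ p) = inj₁ p
      pair (inj₂ q) = inj₂ (inj₁ q)
      coordinates : M ℕ.< ∣ y₁ ∣ ⊎ M ℕ.< ∣ y₂ ∣ ⊎ M ℕ.< ∣ y₃ ∣ ⊎ M ℕ.< ∣ y₄ ∣ →
                    M ℕ.< ∣ u ∣ ⊎ M ℕ.< ∣ v ∣ ⊎ M ℕ.< ∣ bit0 (bit1 y₂) ∣ ⊎ M ℕ.< ∣ bit1 y₄ ∣
      coordinates (inj₁ o) =
        pair (apart-by-sum u v (bit1 y₁) (sum-difference (bit1 y₁) (bit0 (bit1 y₃))) (bit1-grows y₁ o))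
      coordinates (inj₂ (inj₁ o)) = inj₂ (inj₂ (inj₁ (bit0-grows (bit1 y₂) (bit1-grows y₂ o))))
      coordinates (inj₂ (inj₂ (inj₁ o))) =
        pair (apart-by-difference u v (bit0 (bit1 y₃)) (difference-difference (bit1 y₁) (bit0 (bit1 y₃)))
                                  (bit0-grows (bit1 y₃) (bit1-grows y₃ o)))
      coordinates (inj₂ (inj₂ (inj₂ o))) = inj₂ (inj₂ (inj₂ (bit1-grows y₄ o)))

    -- Completing squares, 8 · x(x-1)/2 + 1 = (2x - 1)², and 2 X₁² + 8 X₃² = (X₁ + 2X₃)² + (X₁ - 2X₃)²
    -- for Xᵢ = 2xᵢ - 1 = bit1 (xᵢ - 1).
    t-summand-completed : ∀ x₁ x₂ x₃ x₄ → χ₀ (+ n - weighted a (2 ℕ.* a) (4 ℕ.* a) b tri x₁ x₂ x₃ x₄)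
                                          ≡ T⁴ (x₁ - + 1) (x₂ - + 1) (x₃ - + 1) (x₄ - + 1)
    t-summand-completed x₁ x₂ x₃ x₄ = begin
      χ₀ (+ n - weighted a (2 ℕ.* a) (4 ℕ.* a) b tri x₁ x₂ x₃ x₄)
        ≡⟨ cong (λ q → χ₀ (+ n - q)) (trans (weighted-cong tri x₁ x₂ x₃ x₄ +a≡A (+[c*a]≡c*A 2) (+[c*a]≡c*A 4) +b≡B)
                                            (regroup A B (tri x₁) (tri x₂) (tri x₃) (tri x₄))) ⟩
      χ₀ (+ n - (A * (tri x₁ + + 2 * tri x₂ + + 4 * tri x₃) + B * tri x₄))
        ≡⟨ sol-16 (X x₁ + bit0 (X x₃)) (X x₁ - bit0 (X x₃)) (bit0 (X x₂)) (X x₄) (tri x₁ + + 2 * tri x₂ + + 4 * tri x₃) (tri x₄)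
                  squares (shifted-odd-square x₄) ⟨
      T⁴ (x₁ - + 1) (x₂ - + 1) (x₃ - + 1) (x₄ - + 1) ∎
      where
      open ≡-Reasoning
      X : ℤ → ℤ
      X x = bit1 (x - + 1)
      regroup : ∀ A B T₁ T₂ T₃ T₄ → A * T₁ + + 2 * A * T₂ + + 4 * A * T₃ + B * T₄
                                    ≡ A * (T₁ + + 2 * T₂ + + 4 * T₃) + B * T₄
      regroup = solve-∀
      shifted-odd-square : ∀ x → X x * X x ≡ + 8 * tri x + + 1
      shifted-odd-square x = trans (odd-square (x - + 1)) (cong (λ y → + 8 * tri y + + 1) (cancel x))
        where
        cancel : ∀ x → x - + 1 + + 1 ≡ x
        cancel = solve-∀
      expand : ∀ X₁ X₂ X₃ → (X₁ + (X₃ + X₃)) * (X₁ + (X₃ + X₃)) + (X₁ - (X₃ + X₃)) * (X₁ - (X₃ + X₃))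
                            + (X₂ + X₂) * (X₂ + X₂)
                            ≡ + 2 * (X₁ * X₁) + + 4 * (X₂ * X₂) + + 8 * (X₃ * X₃)
      expand = solve-∀
      collect : ∀ T₁ T₂ T₃ → + 2 * (+ 8 * T₁ + + 1) + + 4 * (+ 8 * T₂ + + 1) + + 8 * (+ 8 * T₃ + + 1)
                             ≡ + 16 * (T₁ + + 2 * T₂ + + 4 * T₃) + + 14
      collect = solve-∀
      squares : (X x₁ + bit0 (X x₃)) * (X x₁ + bit0 (X x₃)) + (X x₁ - bit0 (X x₃)) * (X x₁ - bit0 (X x₃))
                + bit0 (X x₂) * bit0 (X x₂) ≡ + 16 * (tri x₁ + + 2 * tri x₂ + + 4 * tri x₃) + + 14
      squares = trans (expand (X x₁) (X x₂) (X x₃))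
                      (trans (cong₂ (λ PQ R → PQ + + 8 * R)
                                    (cong₂ (λ P Q → + 2 * P + + 4 * Q) (shifted-odd-square x₁) (shifted-odd-square x₂))
                                    (shifted-odd-square x₃))
                             (collect (tri x₁) (tri x₂) (tri x₃)))

    t-as-T : t L₃ n ≡ ∑² M T
    t-as-T = begin
      t L₃ n
        ≡⟨ countBox-∑⁴ tri (suc n) a (2 ℕ.* a) (4 ℕ.* a) b (+ n) ⟩
      ∑⁴ (suc n) g
        ≡⟨ ∑⁴-enlarge (suc n) (suc M) g (countBox-supported tri triN 1 n a (2 ℕ.* a) (4 ℕ.* a) b tri≡triN ∣x∣≤1+triN)
                      (s≤s n≤M) ⟨
      ∑⁴ (suc M) g
        ≡⟨ ∑⁴-cong (suc M) t-summand-completed ⟩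
      ∑⁴ (suc M) (λ x₁ x₂ x₃ x₄ → T⁴ (x₁ - + 1) (x₂ - + 1) (x₃ - + 1) (x₄ - + 1))
        ≡⟨ ∑⁴-shift M (suc M) (- + 1) T⁴ T⁴-supported (ℕₚ.≤-reflexive (ℕₚ.+-comm M 1)) ⟩
      ∑⁴ M T⁴
        ≡⟨ ∑³-swap₂₃ M (λ y₁ y₃ y₂ → ∑ M (T⁴ y₁ y₂ y₃)) ⟩
      ∑² M T ∎
      where
      open ≡-Reasoning
      g : ℤ → ℤ → ℤ → ℤ → ℕ
      g x₁ x₂ x₃ x₄ = χ₀ (+ n - weighted a (2 ℕ.* a) (4 ℕ.* a) b tri x₁ x₂ x₃ x₄)
      n≤M : n ℕ.≤ M
      n≤M = ℕₚ.≤-trans (ℕₚ.m≤n*m n 16) (ℕₚ.≤-trans (ℕₚ.m≤m+n _ (14 ℕ.* a)) (ℕₚ.m≤m+n _ (2 ℕ.* b)))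

    Nᵒᵒᵉ-as-t : Nᵒᵒᵉ M ≡ 2 ℕ.* t L₃ n
    Nᵒᵒᵉ-as-t = begin
      Nᵒᵒᵉ M                                                     ≡⟨ Nᵒᵒᵉ-as-H ⟩
      ∑² M (λ i j → H (bit1 i) (bit1 j))                         ≡⟨ ∑²-H-rotated ⟨
      ∑² M (λ x y → H (x + y) (x - y))                           ≡⟨ ∑²-H-rotated≡2*mixed ⟩
      2 ℕ.* ∑² M (λ p q → H (bit0 p + bit1 q) (bit0 p - bit1 q)) ≡⟨ cong (2 ℕ.*_) (trans ∑²-H-mixed (sym t-as-T)) ⟩
      2 ℕ.* t L₃ n                                               ∎
      where open ≡-Reasoning

    N-identity₂ : 6 ℕ.* t L₃ n ℕ.+ N L₂ (4 ℕ.* n ℕ.+ (7 ℕ.* α ℕ.+ β ℕ.+ 4)) ≡ N L₂ M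
    N-identity₂ = begin
      6 ℕ.* t L₃ n ℕ.+ N L₂ Q          ≡⟨ regroup (t L₃ n) (N L₂ Q) ⟩
      N L₂ Q ℕ.+ 3 ℕ.* (2 ℕ.* t L₃ n)  ≡⟨ cong₂ (λ x y → x ℕ.+ 3 ℕ.* y) (sym (trans (cong Nᵉᵉᵉ (M≡4*Q n α β)) (Nᵉᵉᵉ-4* Q)))
                                                                       (sym Nᵒᵒᵉ-as-t) ⟩
      Nᵉᵉᵉ M ℕ.+ 3 ℕ.* Nᵒᵒᵉ M           ≡⟨ N-parity-split M (2 ℕ.* Q) (M≡2*2*Q n α β) ⟨
      N L₂ M                           ∎
      where
      open ≡-Reasoning
      Q : ℕ
      Q = 4 ℕ.* n ℕ.+ (7 ℕ.* α ℕ.+ β ℕ.+ 4)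
      M≡4*Q : ∀ n α β → 16 ℕ.* n ℕ.+ 14 ℕ.* suc (2 ℕ.* α) ℕ.+ 2 ℕ.* suc (2 ℕ.* β)
                        ≡ 4 ℕ.* (4 ℕ.* n ℕ.+ (7 ℕ.* α ℕ.+ β ℕ.+ 4))
      M≡4*Q = ℕ-Solver.solve-∀
      M≡2*2*Q : ∀ n α β → 16 ℕ.* n ℕ.+ 14 ℕ.* suc (2 ℕ.* α) ℕ.+ 2 ℕ.* suc (2 ℕ.* β)
                          ≡ 2 ℕ.* (2 ℕ.* (4 ℕ.* n ℕ.+ (7 ℕ.* α ℕ.+ β ℕ.+ 4)))
      M≡2*2*Q = ℕ-Solver.solve-∀
      regroup : ∀ x y → 6 ℕ.* x ℕ.+ y ≡ y ℕ.+ 3 ℕ.* (2 ℕ.* x)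
      regroup = ℕ-Solver.solve-∀

open import Data.Nat using (_+_; _*_; _/_; NonZero)
open import Data.Nat.DivMod using (m*n/n≡m)
open import Data.List using (_∷_; [])
open import Data.Product using (_×_)

theorem5p10 : (a b n : ℕ) → Odd a → Odd b → .{{_ : NonZero n}} →
    (3 * N (a ∷ a ∷ 2 * a ∷ b ∷ []) (2 * n + a + b)
      ≡ N (a ∷ a ∷ a ∷ 2 * b ∷ []) (4 * n + 2 * a + 2 * b)
        + 2 * N (a ∷ a ∷ a ∷ 2 * b ∷ []) (n + (a + b) / 2))
    × (6 * t (a ∷ 2 * a ∷ 4 * a ∷ b ∷ []) n
        + N (a ∷ a ∷ a ∷ 2 * b ∷ []) (4 * n + (7 * a + b) / 2)
      ≡ N (a ∷ a ∷ a ∷ 2 * b ∷ []) (16 * n + 14 * a + 2 * b))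
theorem5p10 a b n (α , refl) (β , refl) = first , second
  where
  open Forms α β using (L₁; L₂; L₃; N-identity₁; N-identity₂)
  open ≡-Reasoning
  Q : ℕ
  Q = n + (α + β + 1)
  halve : ∀ c m k → m ≡ k * 2 → c + m / 2 ≡ c + k
  halve c m k refl = cong (_+_ c) (m*n/n≡m k 2)
  2*Q≡ : ∀ n α β → 2 * n + suc (2 * α) + suc (2 * β) ≡ 2 * (n + (α + β + 1))
  2*Q≡ = ℕ-Solver.solve-∀
  4*Q≡ : ∀ n α β → 4 * n + 2 * suc (2 * α) + 2 * suc (2 * β) ≡ 4 * (n + (α + β + 1))
  4*Q≡ = ℕ-Solver.solve-∀
  a+b≡ : ∀ α β → suc (2 * α) + suc (2 * β) ≡ (α + β + 1) * 2
  a+b≡ = ℕ-Solver.solve-∀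
  7a+b≡ : ∀ α β → 7 * suc (2 * α) + suc (2 * β) ≡ (7 * α + β + 4) * 2
  7a+b≡ = ℕ-Solver.solve-∀
  first : 3 * N L₁ (2 * n + a + b) ≡ N L₂ (4 * n + 2 * a + 2 * b) + 2 * N L₂ (n + (a + b) / 2)
  first = begin
    3 * N L₁ (2 * n + a + b)     ≡⟨ cong (λ m → 3 * N L₁ m) (2*Q≡ n α β) ⟩
    3 * N L₁ (2 * Q)             ≡⟨ N-identity₁ Q ⟩
    N L₂ (4 * Q) + 2 * N L₂ Q    ≡⟨ cong₂ (λ m m′ → N L₂ m + 2 * N L₂ m′) (4*Q≡ n α β)
                                          (halve n (a + b) (α + β + 1) (a+b≡ α β)) ⟨
    N L₂ (4 * n + 2 * a + 2 * b) + 2 * N L₂ (n + (a + b) / 2) ∎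
  second : 6 * t L₃ n + N L₂ (4 * n + (7 * a + b) / 2) ≡ N L₂ (16 * n + 14 * a + 2 * b)
  second = trans (cong (λ m → 6 * t L₃ n + N L₂ m) (halve (4 * n) (7 * a + b) (7 * α + β + 4) (7a+b≡ α β)))
                 (N-identity₂ n)
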